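{- Let $m\ge 1$ and $k_1,\dots,k_c\in\{0,\dots,m\}$. Choose subsets $A_1,\dots,A_c\subseteq[m]$ independently with $A_d$ uniformly random of size $k_d$, and let $X_\cap=|A_1\cap\dots\cap A_c|$. For integers $i$ with $\prod_{l=1}^c(i-k_l)\neq 0$ and $1\le j\le c$ define $$Q_{m,\vec k}(i,j)=\frac{\sum_{u=j}^{c}(-1)^{c-u}\sum_{v=j}^{u}S(u,v)\binom{i}{v-j}(v-1)!\Big[j\binom{c-1}{u-1}(m+1)^{c-u}-v\,e_{c-u}(\vec k)\Big]}{\prod_{l=1}^c(i-k_l)},$$ where $e_s(\vec k)$ is the $s$-th elementary symmetric polynomial in $k_1,\dots,k_c$. Then for such $i$, $$\mathbb{P}[X_\cap=i]=\sum_{j=1}^{c-1}(-1)^j\binom{i+j}{j}Q_{m,\vec k}(i,j)\,\mathbb{P}[X_\cap=i+j].$$ Moreover, writing $\mu_{[r]}=\mathbb{E}[X_\cap^{\underline{r}}]$ and $b_{(r)}=\mathbb{E}[\binom{X_\cap}{r}]$, $$\mu_{[r+1]}=(m-r)\Big(\prod_{j=1}^c\frac{k_j-r}{m-r}\Big)\mu_{[r]}\quad\text{and}\quad b_{(r+1)}=\frac{m-r}{r+1}\Big(\prod_{j=1}^c\frac{k_j-r}{m-r}\Big)b_{(r)}.$$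
   Context: $S(u,v)$ denotes the Stirling number of the second kind; $x^{\underline{r}}=x(x-1)\cdots(x-r+1)$ is the falling factorial. -}

module Defs where

open import Data.Nat as ℕ using (ℕ; zero; suc; _∸_; _≤_)
open import Data.Nat.Combinatorics using (_C_)
open import Data.Nat.ListAction using (sum)
open import Data.Integer as ℤ using (ℤ; +_; -[1+_])
open import Data.Rational as ℚ using (ℚ; 0ℚ; 1ℚ)
open import Data.Bool using (Bool; true; false)
open import Data.List as List using (List; []; _∷_; map; concatMap; length; filter; upTo; foldr)
open import Data.Vec as Vec using (Vec; []; _∷_)
open import Data.Fin.Subset using (Subset; inside; outside; _∩_; ⊤; ∣_∣)
open import Relation.Binary.PropositionalEquality using (_≡_)

S : ℕ → ℕ → ℕ
S zero    zero    = 1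
S zero    (suc v) = 0
S (suc u) zero    = 0
S (suc u) (suc v) = suc v ℕ.* S u (suc v) ℕ.+ S u v

fall : ℕ → ℕ → ℕ
fall x zero    = 1
fall x (suc r) = x ℕ.* fall (x ∸ 1) r

esym : ∀ {c} → ℕ → Vec ℕ c → ℤ
esym zero    []       = + 1
esym (suc s) []       = + 0
esym zero    (k ∷ ks) = + 1
esym (suc s) (k ∷ ks) = esym (suc s) ks ℤ.+ (+ k) ℤ.* esym s ks

-- integer range [a, b] (empty if b < a)
range : ℕ → ℕ → List ℕ
range a b = map (a ℕ.+_) (upTo (suc b ∸ a))

sumℤ : List ℤ → ℤ
sumℤ = foldr ℤ._+_ (+ 0)

sumℚ : List ℚ → ℚ
sumℚ = foldr ℚ._+_ 0ℚ

prodℤ : List ℤ → ℤ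
prodℤ = foldr ℤ._*_ (+ 1)

prodℚ : List ℚ → ℚ
prodℚ = foldr ℚ._*_ 1ℚ

sign : ℕ → ℤ
sign zero    = + 1
sign (suc n) = ℤ.- sign n

-- Rational quotients with the convention x/0 = 0 (only ever used with nonzero divisors
-- in the statement)
divℕ : ℕ → ℕ → ℚ
divℕ a zero    = 0ℚ
divℕ a (suc d) = (+ a) ℚ./ suc d

divℤ : ℤ → ℤ → ℚ
divℤ a (+ zero)  = 0ℚ
divℤ a (+ suc d) = a ℚ./ suc d
divℤ a -[1+ d ]  = (ℤ.- a) ℚ./ suc d

-- The sample space is the (finite) list of all tuples
-- (A_1,…,A_c) with |A_d| = k_d, each tuple equally likely.

allSubsets : (m : ℕ) → List (Subset m)
allSubsets zero    = [] ∷ []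
allSubsets (suc m) = map (inside ∷_) (allSubsets m) List.++ map (outside ∷_) (allSubsets m)

subsetsOfSize : (m k : ℕ) → List (Subset m)
subsetsOfSize m k = filter (λ A → ∣ A ∣ ℕ.≟ k) (allSubsets m)

tuples : (m : ℕ) {c : ℕ} → Vec ℕ c → List (Vec (Subset m) c)
tuples m []       = [] ∷ []
tuples m (k ∷ ks) = concatMap (λ A → map (A ∷_) (tuples m ks)) (subsetsOfSize m k)

Xcap : ∀ {m c} → Vec (Subset m) c → ℕ
Xcap As = ∣ Vec.foldr _ _∩_ ⊤ As ∣

Prob : (m : ℕ) {c : ℕ} → Vec ℕ c → ℕ → ℚ
Prob m ks i =
  divℕ (length (filter (λ As → Xcap As ℕ.≟ i) (tuples m ks))) (length (tuples m ks))

Exp : (m : ℕ) {c : ℕ} → Vec ℕ c → (ℕ → ℕ) → ℚ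
Exp m ks f = divℕ (sum (map (λ As → f (Xcap As)) (tuples m ks))) (length (tuples m ks))

μ : (m : ℕ) {c : ℕ} → Vec ℕ c → ℕ → ℚ
μ m ks r = Exp m ks (λ x → fall x r)

b : (m : ℕ) {c : ℕ} → Vec ℕ c → ℕ → ℚ
b m ks r = Exp m ks (λ x → x C r)

denomQ : ∀ {c} → Vec ℕ c → ℕ → ℤ
denomQ ks i = prodℤ (map (λ k → (+ i) ℤ.- (+ k)) (Vec.toList ks))

numQ : (m : ℕ) {c : ℕ} → Vec ℕ c → ℕ → ℕ → ℤ
numQ m {c} ks i j =
  sumℤ (map (λ u → sign (c ∸ u) ℤ.*
    sumℤ (map (λ v →
        (+ (S u v ℕ.* (i C (v ∸ j)) ℕ.* ((v ∸ 1) ℕ.!))) ℤ.*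
        ( (+ (j ℕ.* ((c ∸ 1) C (u ∸ 1)) ℕ.* ((m ℕ.+ 1) ℕ.^ (c ∸ u))))
          ℤ.- (+ v) ℤ.* esym (c ∸ u) ks))
      (range j u)))
    (range j c))

Q : (m : ℕ) {c : ℕ} → Vec ℕ c → ℕ → ℕ → ℚ
Q m ks i j = divℤ (numQ m ks i j) (denomQ ks i)

ratioProd : (m : ℕ) {c : ℕ} → Vec ℕ c → ℕ → ℚ
ratioProd m ks r = prodℚ (map (λ k → divℤ ((+ k) ℤ.- (+ r)) ((+ m) ℤ.- (+ r))) (Vec.toList ks))

module Submission where

-- All statements are integer identities on the finite sample space
-- `tuples m ks`, divided by its size at the very end (`Represents`).  A tuple
-- is counted once for each r-set inside all A_d, so the binomial moments are
-- B_r = Σ C(X∩, r) = C(m, r) ∏_d C(m-r, k_d-r) (`moment≡`), and absorption gives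
-- (r+1)(m-r)^(c-1) B_{r+1} = ∏_d (k_d - r) B_r (`momentRecurrence`); this is
-- the recurrence for b_(r), and for μ_[r] = r! b_(r).  For the law, the same
-- relation reads Σ φ_r(X∩) = 0 with φ_r(x) = C(x, r) h_r(x).  Combining these
-- with weights (-1)^(r-i) C(r, i) gives, pointwise at x = i + j, C(x, i) times
-- the j-th finite difference of s ↦ h_{i+s}(x); expanding powers in Stirling
-- numbers this is ±numQ(i, j) (`finiteDifferenceIsNumQ`), zero for j ≥ c, and
-- -∏_d (k_d - i) for j = 0.  Summed over the sample space this is the linear
-- relation `countRecurrence` among the counts N_a = #{X∩ = a}.

module Development where

  open import Data.Nat as ℕ using (ℕ; zero; suc; _∸_; z≤n; s≤s; _!)
  import Data.Nat.Properties as ℕP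
  open import Data.Nat.Combinatorics using (_C_; nCk+nC[k+1]≡[n+1]C[k+1])
  open import Data.Nat.ListAction using (sum)
  open import Data.Nat.ListAction.Properties using (sum-++)
  import Data.Nat.Tactic.RingSolver as ℕSolver
  open import Data.Integer using (ℤ; +_; -[1+_]; _+_; _*_; -_; _-_; 0ℤ; 1ℤ; _^_)
  open import Data.Integer.Properties hiding (_≟_)
  open import Data.Integer.Tactic.RingSolver using (solve-∀)
  open import Data.Rational as ℚ using (ℚ; toℚᵘ)
  import Data.Rational.Properties as ℚP
  open import Data.Rational.Unnormalised as ℚᵘ using (ℚᵘ; mkℚᵘ; *≡*; ↥_; ↧_)
  import Data.Rational.Unnormalised.Properties as ℚᵘP
  open import Data.Bool using (true; false; if_then_else_)
  open import Data.Empty using (⊥-elim)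
  open import Data.Product using (_,_)
  open import Data.Sum using (inj₁; inj₂)
  open import Data.List using (List; []; _∷_; map; filter; length; concatMap; upTo; applyUpTo; _++_)
  import Data.List.Properties as ListP
  import Data.List.Relation.Unary.All as ListAll
  open import Data.Vec as Vec using (Vec; []; _∷_)
  open import Data.Vec.Relation.Unary.All using (All; []; _∷_)
  open import Data.Fin.Subset using (Subset; inside; outside; _∩_; ⊤; ∣_∣)
  open import Data.Fin.Subset.Properties using (∩-assoc; ∩-identityʳ; ∩-identityˡ; ∣p∣≤n; ∣⊤∣≡n)
  open import Function using (_∘_; id)
  open import Relation.Binary.PropositionalEquality hiding (J)
  open import Relation.Nullary using (yes; no; does)
  open import Relation.Nullary.Decidable using (dec-true; dec-false)
  open import Relation.Unary using (Pred; Decidable)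
  open import Level using (0ℓ)
  open import Defs hiding (b)

  Σ : ℕ → (ℕ → ℤ) → ℤ
  Σ zero    f = 0ℤ
  Σ (suc n) f = f 0 + Σ n (λ s → f (suc s))

  Σ-cong : ∀ n {f g : ℕ → ℤ} → (∀ s → s ℕ.< n → f s ≡ g s) → Σ n f ≡ Σ n g
  Σ-cong zero    h = refl
  Σ-cong (suc n) h = cong₂ _+_ (h 0 (s≤s z≤n)) (Σ-cong n (λ s p → h (suc s) (s≤s p)))

  Σ-ext : ∀ n {f g : ℕ → ℤ} → (∀ s → f s ≡ g s) → Σ n f ≡ Σ n g
  Σ-ext n h = Σ-cong n (λ s _ → h s)

  Σ-zero : ∀ n {f : ℕ → ℤ} → (∀ s → s ℕ.< n → f s ≡ 0ℤ) → Σ n f ≡ 0ℤ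
  Σ-zero n h = trans (Σ-cong n h) (Σ-const0 n)
    where
    Σ-const0 : ∀ n → Σ n (λ _ → 0ℤ) ≡ 0ℤ
    Σ-const0 zero    = refl
    Σ-const0 (suc n) = trans (+-identityˡ _) (Σ-const0 n)

  Σ-+ : ∀ n (f g : ℕ → ℤ) → Σ n (λ s → f s + g s) ≡ Σ n f + Σ n g
  Σ-+ zero    f g = refl
  Σ-+ (suc n) f g = trans (cong (λ z → (f 0 + g 0) + z) (Σ-+ n _ _)) (swap-middle (f 0) (g 0) _ _)
    where
    swap-middle : ∀ a b c d → a + b + (c + d) ≡ a + c + (b + d)
    swap-middle = solve-∀

  Σ-*ˡ : ∀ n (a : ℤ) (f : ℕ → ℤ) → Σ n (λ s → a * f s) ≡ a * Σ n f
  Σ-*ˡ zero    a f = sym (*-zeroʳ a)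
  Σ-*ˡ (suc n) a f = trans (cong (λ z → a * f 0 + z) (Σ-*ˡ n a _)) (sym (*-distribˡ-+ a (f 0) _))

  Σ-neg : ∀ n (f : ℕ → ℤ) → Σ n (λ s → - f s) ≡ - Σ n f
  Σ-neg zero    f = refl
  Σ-neg (suc n) f = trans (cong (λ z → - f 0 + z) (Σ-neg n _)) (sym (neg-distrib-+ (f 0) _))

  Σ-split : ∀ a b (f : ℕ → ℤ) → Σ (a ℕ.+ b) f ≡ Σ a f + Σ b (λ s → f (a ℕ.+ s))
  Σ-split zero    b f = sym (+-identityˡ _)
  Σ-split (suc a) b f = trans (cong (λ z → f 0 + z) (Σ-split a b _)) (sym (+-assoc (f 0) _ _))

  Σ-last : ∀ n (f : ℕ → ℤ) → Σ (suc n) f ≡ Σ n f + f n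
  Σ-last n f = begin
    Σ (suc n) f                 ≡⟨ cong (λ k → Σ k f) (ℕP.+-comm 1 n) ⟩
    Σ (n ℕ.+ 1) f               ≡⟨ Σ-split n 1 f ⟩
    Σ n f + (f (n ℕ.+ 0) + 0ℤ)  ≡⟨ cong (λ z → Σ n f + z) (trans (+-identityʳ _) (cong f (ℕP.+-identityʳ n))) ⟩
    Σ n f + f n                 ∎
    where open ≡-Reasoning

  Σ-shift : ∀ n (f g : ℕ → ℤ) → (∀ v → v ℕ.< n → f (suc v) ≡ g v) → g n ≡ 0ℤ → Σ (suc n) f ≡ f 0 + Σ (suc n) g
  Σ-shift n f g f∘suc≡g gₙ≡0 = begin
    f 0 + Σ n (λ v → f (suc v))  ≡⟨ cong (λ z → f 0 + z) (Σ-cong n f∘suc≡g) ⟩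
    f 0 + Σ n g                  ≡⟨ cong (λ z → f 0 + z) (sym (trans (Σ-last n g) (trans (cong (λ z → Σ n g + z) gₙ≡0) (+-identityʳ (Σ n g))))) ⟩
    f 0 + Σ (suc n) g            ∎
    where open ≡-Reasoning

  Σ-dropZeroPrefix : ∀ n k (f : ℕ → ℤ) → (∀ s → s ℕ.< n → f s ≡ 0ℤ) →
                     Σ (n ℕ.+ k) f ≡ Σ k (λ s → f (n ℕ.+ s))
  Σ-dropZeroPrefix n k f h =
    trans (Σ-split n k f) (trans (cong (_+ Σ k (λ s → f (n ℕ.+ s))) (Σ-zero n h)) (+-identityˡ _))

  Σ-dropZeroSuffix : ∀ n k (f : ℕ → ℤ) → (∀ s → n ℕ.≤ s → f s ≡ 0ℤ) → Σ (n ℕ.+ k) f ≡ Σ n f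
  Σ-dropZeroSuffix n k f h =
    trans (Σ-split n k f)
          (trans (cong (λ z → Σ n f + z) (Σ-zero k (λ s _ → h (n ℕ.+ s) (ℕP.m≤m+n n s)))) (+-identityʳ _))

  Σ-swap : ∀ a b (f : ℕ → ℕ → ℤ) → Σ a (λ s → Σ b (f s)) ≡ Σ b (λ t → Σ a (λ s → f s t))
  Σ-swap zero    b f = sym (Σ-zero b (λ _ _ → refl))
  Σ-swap (suc a) b f = trans (cong (λ z → Σ b (f 0) + z) (Σ-swap a b (λ s t → f (suc s) t)))
                             (sym (Σ-+ b (f 0) (λ t → Σ a (λ s → f (suc s) t))))

  Σ-swap-scaled : ∀ a b (α β : ℕ → ℤ) (γ : ℕ → ℕ → ℤ) →
                  Σ a (λ s → α s * Σ b (λ w → β w * γ s w)) ≡ Σ b (λ w → β w * Σ a (λ s → α s * γ s w))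
  Σ-swap-scaled a b α β γ = begin
    Σ a (λ s → α s * Σ b (λ w → β w * γ s w))   ≡⟨ Σ-ext a (λ s → sym (Σ-*ˡ b (α s) _)) ⟩
    Σ a (λ s → Σ b (λ w → α s * (β w * γ s w))) ≡⟨ Σ-ext a (λ s → Σ-ext b (λ w → exchange (α s) (β w) (γ s w))) ⟩
    Σ a (λ s → Σ b (λ w → β w * (α s * γ s w))) ≡⟨ Σ-swap a b _ ⟩
    Σ b (λ w → Σ a (λ s → β w * (α s * γ s w))) ≡⟨ Σ-ext b (λ w → Σ-*ˡ a (β w) _) ⟩
    Σ b (λ w → β w * Σ a (λ s → α s * γ s w))   ∎
    where
    open ≡-Reasoning
    exchange : ∀ a b g → a * (b * g) ≡ b * (a * g)
    exchange = solve-∀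

  ∸-suc : ∀ n w → w ℕ.< n → n ∸ w ≡ suc (n ∸ suc w)
  ∸-suc n w w<n = ℕP.+-∸-assoc 1 w<n

  Σ-reverse : ∀ c (f : ℕ → ℤ) → Σ (suc c) f ≡ Σ (suc c) (λ t → f (c ∸ t))
  Σ-reverse zero    f = refl
  Σ-reverse (suc c) f = begin
    f 0 + Σ (suc c) (λ s → f (suc s))
      ≡⟨ cong (λ z → f 0 + z) (Σ-reverse c (λ s → f (suc s))) ⟩
    f 0 + Σ (suc c) (λ t → f (suc (c ∸ t)))
      ≡⟨ +-comm (f 0) _ ⟩
    Σ (suc c) (λ t → f (suc (c ∸ t))) + f 0
      ≡⟨ cong₂ _+_ (Σ-cong (suc c) (λ t p → cong f (sym (∸-suc (suc c) t p)))) (cong f (sym (ℕP.n∸n≡0 (suc c)))) ⟩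
    Σ (suc c) (λ t → f (suc c ∸ t)) + f (suc c ∸ suc c)
      ≡⟨ sym (Σ-last (suc c) (λ t → f (suc c ∸ t))) ⟩
    Σ (suc (suc c)) (λ t → f (suc c ∸ t)) ∎
    where open ≡-Reasoning

  sumℤ-range : ∀ a b (f : ℕ → ℤ) → sumℤ (map f (range a b)) ≡ Σ (suc b ∸ a) (λ s → f (a ℕ.+ s))
  sumℤ-range a b f = trans (cong sumℤ (sym (ListP.map-∘ (upTo (suc b ∸ a)))))
                           (sum-applyUpTo (suc b ∸ a) (λ s → f (a ℕ.+ s)) id)
    where
    sum-applyUpTo : ∀ n (g : ℕ → ℤ) (h : ℕ → ℕ) → sumℤ (map g (applyUpTo h n)) ≡ Σ n (g ∘ h)
    sum-applyUpTo zero    g h = refl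
    sum-applyUpTo (suc n) g h = cong (λ z → g (h 0) + z) (sum-applyUpTo n g (h ∘ suc))

  sumℤ-range-padded : ∀ a b (f f' : ℕ → ℤ) → (∀ v → a ℕ.≤ v → f v ≡ f' v) →
                      (∀ v → v ℕ.< a → f' v ≡ 0ℤ) → sumℤ (map f (range a b)) ≡ Σ (suc b) f'
  sumℤ-range-padded a b f f' agree pad with a ℕ.≤? suc b
  ... | yes a≤ = begin
    sumℤ (map f (range a b))               ≡⟨ sumℤ-range a b f ⟩
    Σ (suc b ∸ a) (λ s → f (a ℕ.+ s))      ≡⟨ Σ-ext (suc b ∸ a) (λ s → agree (a ℕ.+ s) (ℕP.m≤m+n a s)) ⟩
    Σ (suc b ∸ a) (λ s → f' (a ℕ.+ s))     ≡⟨ sym (Σ-dropZeroPrefix a (suc b ∸ a) f' pad) ⟩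
    Σ (a ℕ.+ (suc b ∸ a)) f'               ≡⟨ cong (λ z → Σ z f') (ℕP.m+[n∸m]≡n a≤) ⟩
    Σ (suc b) f'                           ∎
    where open ≡-Reasoning
  ... | no a≰ = begin
    sumℤ (map f (range a b))               ≡⟨ sumℤ-range a b f ⟩
    Σ (suc b ∸ a) (λ s → f (a ℕ.+ s))      ≡⟨ cong (λ z → Σ z (λ s → f (a ℕ.+ s))) (ℕP.m≤n⇒m∸n≡0 b<a) ⟩
    0ℤ                                     ≡⟨ sym (Σ-zero (suc b) (λ v p → pad v (ℕP.<-≤-trans p b<a))) ⟩
    Σ (suc b) f'                           ∎
    where
    open ≡-Reasoning
    b<a = ℕP.<⇒≤ (ℕP.≰⇒> a≰)

  ΣL : ∀ {A : Set} → List A → (A → ℤ) → ℤ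
  ΣL L f = sumℤ (map f L)

  ΣL-ext : ∀ {A : Set} (L : List A) {f g : A → ℤ} → (∀ x → f x ≡ g x) → ΣL L f ≡ ΣL L g
  ΣL-ext []      h = refl
  ΣL-ext (x ∷ L) h = cong₂ _+_ (h x) (ΣL-ext L h)

  ΣL-+ : ∀ {A : Set} (L : List A) (f g : A → ℤ) → ΣL L (λ x → f x + g x) ≡ ΣL L f + ΣL L g
  ΣL-+ []      f g = refl
  ΣL-+ (x ∷ L) f g = trans (cong (λ z → (f x + g x) + z) (ΣL-+ L f g)) (swap-middle (f x) (g x) _ _)
    where
    swap-middle : ∀ a b c d → a + b + (c + d) ≡ a + c + (b + d)
    swap-middle = solve-∀

  ΣL-*ˡ : ∀ {A : Set} (L : List A) a (f : A → ℤ) → ΣL L (λ x → a * f x) ≡ a * ΣL L f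
  ΣL-*ˡ []      a f = sym (*-zeroʳ a)
  ΣL-*ˡ (x ∷ L) a f = trans (cong (λ z → a * f x + z) (ΣL-*ˡ L a f)) (sym (*-distribˡ-+ a (f x) _))

  ΣL-neg : ∀ {A : Set} (L : List A) (f : A → ℤ) → ΣL L (λ x → - f x) ≡ - ΣL L f
  ΣL-neg []      f = refl
  ΣL-neg (x ∷ L) f = trans (cong (λ z → - f x + z) (ΣL-neg L f)) (sym (neg-distrib-+ (f x) _))

  ΣL-Σ : ∀ {A : Set} (L : List A) n (g : A → ℕ → ℤ) → ΣL L (λ x → Σ n (g x)) ≡ Σ n (λ r → ΣL L (λ x → g x r))
  ΣL-Σ []      n g = sym (Σ-zero n (λ _ _ → refl))
  ΣL-Σ (x ∷ L) n g = trans (cong (λ z → Σ n (g x) + z) (ΣL-Σ L n g)) (sym (Σ-+ n (g x) _))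

  ΣL-swap : ∀ {A B : Set} (L : List A) (R : List B) (g : A → B → ℤ) →
            ΣL L (λ x → ΣL R (g x)) ≡ ΣL R (λ y → ΣL L (λ x → g x y))
  ΣL-swap []      R g = sym (ΣL-zero R)
    where
    ΣL-zero : ∀ {B : Set} (R : List B) → ΣL R (λ _ → 0ℤ) ≡ 0ℤ
    ΣL-zero []      = refl
    ΣL-zero (_ ∷ R) = trans (+-identityˡ _) (ΣL-zero R)
  ΣL-swap (x ∷ L) R g = trans (cong (λ z → ΣL R (g x) + z) (ΣL-swap L R g)) (sym (ΣL-+ R (g x) _))

  ΣLℕ : ∀ {A : Set} → List A → (A → ℕ) → ℕ
  ΣLℕ L f = sum (map f L)

  ΣL-pos : ∀ {A : Set} (L : List A) (f : A → ℕ) → ΣL L (λ x → + f x) ≡ + ΣLℕ L f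
  ΣL-pos []      f = refl
  ΣL-pos (x ∷ L) f = trans (cong (λ z → + f x + z) (ΣL-pos L f)) (sym (pos-+ (f x) _))

  ΣLℕ-ext : ∀ {A : Set} (L : List A) {f g : A → ℕ} → (∀ x → f x ≡ g x) → ΣLℕ L f ≡ ΣLℕ L g
  ΣLℕ-ext L h = cong sum (ListP.map-cong h L)

  ΣLℕ-++ : ∀ {A : Set} (xs ys : List A) (f : A → ℕ) → ΣLℕ (xs ++ ys) f ≡ ΣLℕ xs f ℕ.+ ΣLℕ ys f
  ΣLℕ-++ xs ys f = trans (cong sum (ListP.map-++ f xs ys)) (sum-++ (map f xs) (map f ys))

  ΣLℕ-map : ∀ {A B : Set} (g : A → B) (L : List A) (f : B → ℕ) → ΣLℕ (map g L) f ≡ ΣLℕ L (f ∘ g)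
  ΣLℕ-map g L f = cong sum (sym (ListP.map-∘ L))

  ΣLℕ-*ʳ : ∀ {A : Set} (L : List A) (f : A → ℕ) a → ΣLℕ L (λ x → f x ℕ.* a) ≡ ΣLℕ L f ℕ.* a
  ΣLℕ-*ʳ []      f a = refl
  ΣLℕ-*ʳ (x ∷ L) f a = trans (cong (f x ℕ.* a ℕ.+_) (ΣLℕ-*ʳ L f a)) (sym (ℕP.*-distribʳ-+ a (f x) _))

  ΣLℕ-+ : ∀ {A : Set} (L : List A) (f g : A → ℕ) → ΣLℕ L (λ x → f x ℕ.+ g x) ≡ ΣLℕ L f ℕ.+ ΣLℕ L g
  ΣLℕ-+ []      f g = refl
  ΣLℕ-+ (x ∷ L) f g = trans (cong (f x ℕ.+ g x ℕ.+_) (ΣLℕ-+ L f g)) (swap-middle (f x) (g x) _ _)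
    where
    swap-middle : ∀ a b c d → a ℕ.+ b ℕ.+ (c ℕ.+ d) ≡ a ℕ.+ c ℕ.+ (b ℕ.+ d)
    swap-middle = ℕSolver.solve-∀

  ΣLℕ-concatMap : ∀ {A B : Set} (g : A → List B) (L : List A) (f : B → ℕ) →
                  ΣLℕ (concatMap g L) f ≡ ΣLℕ L (λ a → ΣLℕ (g a) f)
  ΣLℕ-concatMap g []      f = refl
  ΣLℕ-concatMap g (x ∷ L) f =
    trans (ΣLℕ-++ (g x) (concatMap g L) f) (cong (ΣLℕ (g x) f ℕ.+_) (ΣLℕ-concatMap g L f))

  length≡ΣLℕ : ∀ {A : Set} (L : List A) → length L ≡ ΣLℕ L (λ _ → 1)
  length≡ΣLℕ []      = refl
  length≡ΣLℕ (x ∷ L) = cong suc (length≡ΣLℕ L)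

  δ : ℕ → ℕ → ℤ
  δ a x = if does (x ℕ.≟ a) then 1ℤ else 0ℤ

  δ-same : ∀ a → δ a a ≡ 1ℤ
  δ-same a = cong (λ t → if t then 1ℤ else 0ℤ) (dec-true (a ℕ.≟ a) refl)

  δ-diff : ∀ a x → x ≢ a → δ a x ≡ 0ℤ
  δ-diff a x x≢a = cong (λ t → if t then 1ℤ else 0ℤ) (dec-false (x ℕ.≟ a) x≢a)

  δ-shift : ∀ b s t → δ (b ℕ.+ s) (b ℕ.+ t) ≡ δ s t
  δ-shift b s t with t ℕ.≟ s
  ... | yes refl = trans (δ-same (b ℕ.+ s)) (sym (δ-same s))
  ... | no t≢s   = trans (δ-diff (b ℕ.+ s) (b ℕ.+ t) (t≢s ∘ ℕP.+-cancelˡ-≡ b t s)) (sym (δ-diff s t t≢s))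

  Σδ-inside : ∀ n t (f : ℕ → ℤ) → t ℕ.< n → Σ n (λ s → f s * δ s t) ≡ f t
  Σδ-inside (suc n) zero f _ = begin
    f 0 * δ 0 0 + Σ n (λ s → f (suc s) * δ (suc s) 0)
      ≡⟨ cong₂ _+_ (trans (cong (f 0 *_) (δ-same 0)) (*-identityʳ (f 0)))
                   (Σ-zero n (λ s _ → trans (cong (f (suc s) *_) (δ-diff (suc s) 0 (λ ()))) (*-zeroʳ (f (suc s))))) ⟩
    f 0 + 0ℤ
      ≡⟨ +-identityʳ _ ⟩
    f 0 ∎
    where open ≡-Reasoning
  Σδ-inside (suc n) (suc t) f (s≤s t<n) = begin
    f 0 * δ 0 (suc t) + Σ n (λ s → f (suc s) * δ (suc s) (suc t))
      ≡⟨ cong₂ _+_ (trans (cong (f 0 *_) (δ-diff 0 (suc t) (λ ()))) (*-zeroʳ (f 0)))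
                   (Σ-ext n (λ s → cong (f (suc s) *_) (δ-shift 1 s t))) ⟩
    0ℤ + Σ n (λ s → f (suc s) * δ s t)
      ≡⟨ +-identityˡ _ ⟩
    Σ n (λ s → f (suc s) * δ s t)
      ≡⟨ Σδ-inside n t (λ s → f (suc s)) t<n ⟩
    f (suc t) ∎
    where open ≡-Reasoning

  Σδ-outside : ∀ n t (f : ℕ → ℤ) → n ℕ.≤ t → Σ n (λ s → f s * δ s t) ≡ 0ℤ
  Σδ-outside n t f n≤t = Σ-zero n (λ s s<n →
    trans (cong (f s *_) (δ-diff s t (λ t≡s → ℕP.<-irrefl (sym t≡s) (ℕP.<-≤-trans s<n n≤t)))) (*-zeroʳ (f s)))

  ΣL-δ : ∀ {A : Set} (L : List A) (X : A → ℕ) a →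
         ΣL L (λ t → δ a (X t)) ≡ + length (filter (λ t → X t ℕ.≟ a) L)
  ΣL-δ []      X a = refl
  ΣL-δ (t ∷ L) X a with does (X t ℕ.≟ a)
  ... | true  = trans (cong (λ z → 1ℤ + z) (ΣL-δ L X a)) (sym (pos-+ 1 _))
  ... | false = trans (+-identityˡ _) (ΣL-δ L X a)

  bin : ℕ → ℕ → ℕ
  bin zero    zero    = 1
  bin zero    (suc k) = 0
  bin (suc n) zero    = 1
  bin (suc n) (suc k) = bin n k ℕ.+ bin n (suc k)

  bin≡C : ∀ n k → bin n k ≡ n C k
  bin≡C zero    zero    = refl
  bin≡C zero    (suc k) = refl
  bin≡C (suc n) zero    = refl
  bin≡C (suc n) (suc k) = trans (cong₂ ℕ._+_ (bin≡C n k) (bin≡C n (suc k))) (nCk+nC[k+1]≡[n+1]C[k+1] n k)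

  bin-vanish : ∀ n k → n ℕ.< k → bin n k ≡ 0
  bin-vanish zero    (suc k) _         = refl
  bin-vanish (suc n) (suc k) (s≤s n<k) = cong₂ ℕ._+_ (bin-vanish n k n<k) (bin-vanish n (suc k) (ℕP.m<n⇒m<1+n n<k))

  bin-n0 : ∀ n → bin n 0 ≡ 1
  bin-n0 zero    = refl
  bin-n0 (suc n) = refl

  bin-nn : ∀ n → bin n n ≡ 1
  bin-nn zero    = refl
  bin-nn (suc n) = cong₂ ℕ._+_ (bin-nn n) (bin-vanish n (suc n) (ℕP.n<1+n n))

  bin-n1 : ∀ n → bin n 1 ≡ n
  bin-n1 zero    = refl
  bin-n1 (suc n) = trans (cong (ℕ._+ bin n 1) (bin-n0 n)) (cong suc (bin-n1 n))

  bin-pos : ∀ m k → k ℕ.≤ m → 0 ℕ.< bin m k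
  bin-pos m       zero    _         = subst (0 ℕ.<_) (sym (bin-n0 m)) (s≤s z≤n)
  bin-pos (suc m) (suc k) (s≤s k≤m) = ℕP.<-≤-trans (bin-pos m k k≤m) (ℕP.m≤m+n (bin m k) _)

  bin-factorial : ∀ k l → bin (k ℕ.+ l) k ℕ.* k ! ℕ.* l ! ≡ (k ℕ.+ l) !
  bin-factorial zero l = trans (cong (λ z → z ℕ.* 1 ℕ.* l !) (bin-n0 l)) (ℕP.+-identityʳ (l !))
  bin-factorial (suc k) zero = begin
    bin (suc k ℕ.+ 0) (suc k) ℕ.* (suc k) ! ℕ.* 1
      ≡⟨ cong (λ z → bin z (suc k) ℕ.* (suc k) ! ℕ.* 1) (ℕP.+-identityʳ (suc k)) ⟩
    bin (suc k) (suc k) ℕ.* (suc k) ! ℕ.* 1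
      ≡⟨ cong (λ z → z ℕ.* (suc k) ! ℕ.* 1) (bin-nn (suc k)) ⟩
    1 ℕ.* (suc k) ! ℕ.* 1
      ≡⟨ trans (ℕP.*-identityʳ _) (ℕP.*-identityˡ _) ⟩
    (suc k) !
      ≡⟨ cong _! (sym (ℕP.+-identityʳ (suc k))) ⟩
    (suc k ℕ.+ 0) ! ∎
    where open ≡-Reasoning
  bin-factorial (suc k) (suc l) = begin
    bin (suc k ℕ.+ suc l) (suc k) ℕ.* (suc k) ! ℕ.* (suc l) !
      ≡⟨ cong (λ z → (bin (k ℕ.+ suc l) k ℕ.+ bin z (suc k)) ℕ.* (suc k) ! ℕ.* (suc l) !) (ℕP.+-suc k l) ⟩
    (x ℕ.+ y) ℕ.* (suc k) ! ℕ.* (suc l) !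
      ≡⟨ distribute x y k l (k !) (l !) ⟩
    suc k ℕ.* (x ℕ.* k ! ℕ.* (suc l) !) ℕ.+ suc l ℕ.* (y ℕ.* (suc k) ! ℕ.* l !)
      ≡⟨ cong₂ (λ a b → suc k ℕ.* a ℕ.+ suc l ℕ.* b) (bin-factorial k (suc l)) (bin-factorial (suc k) l) ⟩
    suc k ℕ.* (k ℕ.+ suc l) ! ℕ.+ suc l ℕ.* (suc k ℕ.+ l) !
      ≡⟨ cong (λ z → suc k ℕ.* z ! ℕ.+ suc l ℕ.* (suc k ℕ.+ l) !) (ℕP.+-suc k l) ⟩
    suc k ℕ.* (suc k ℕ.+ l) ! ℕ.+ suc l ℕ.* (suc k ℕ.+ l) !
      ≡⟨ sym (ℕP.*-distribʳ-+ ((suc k ℕ.+ l) !) (suc k) (suc l)) ⟩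
    (suc k ℕ.+ suc l) ℕ.* (suc k ℕ.+ l) !
      ≡⟨ cong (λ z → (suc k ℕ.+ suc l) ℕ.* z !) (sym (ℕP.+-suc k l)) ⟩
    (suc k ℕ.+ suc l) ! ∎
    where
    open ≡-Reasoning
    x = bin (k ℕ.+ suc l) k
    y = bin (suc k ℕ.+ l) (suc k)
    distribute : ∀ a b k l kf lf → (a ℕ.+ b) ℕ.* (suc k ℕ.* kf) ℕ.* (suc l ℕ.* lf)
                 ≡ suc k ℕ.* (a ℕ.* kf ℕ.* (suc l ℕ.* lf)) ℕ.+ suc l ℕ.* (b ℕ.* (suc k ℕ.* kf) ℕ.* lf)
    distribute = ℕSolver.solve-∀

  private
    factorials≢0 : ∀ a b → ℕ.NonZero (a ! ℕ.* b !)
    factorials≢0 a b = ℕP.m*n≢0 (a !) (b !) {{ℕP._!≢0 a}} {{ℕP._!≢0 b}}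

  bin-symmetric : ∀ a b → bin (a ℕ.+ b) a ≡ bin (a ℕ.+ b) b
  bin-symmetric a b = ℕP.*-cancelʳ-≡ _ _ (a ! ℕ.* b !) {{factorials≢0 a b}} (begin
    bin (a ℕ.+ b) a ℕ.* (a ! ℕ.* b !)   ≡⟨ sym (ℕP.*-assoc (bin (a ℕ.+ b) a) (a !) (b !)) ⟩
    bin (a ℕ.+ b) a ℕ.* a ! ℕ.* b !     ≡⟨ bin-factorial a b ⟩
    (a ℕ.+ b) !                         ≡⟨ cong _! (ℕP.+-comm a b) ⟩
    (b ℕ.+ a) !                         ≡⟨ sym (bin-factorial b a) ⟩
    bin (b ℕ.+ a) b ℕ.* b ! ℕ.* a !     ≡⟨ cong (λ z → bin z b ℕ.* b ! ℕ.* a !) (ℕP.+-comm b a) ⟩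
    bin (a ℕ.+ b) b ℕ.* b ! ℕ.* a !     ≡⟨ ℕP.*-assoc (bin (a ℕ.+ b) b) (b !) (a !) ⟩
    bin (a ℕ.+ b) b ℕ.* (b ! ℕ.* a !)   ≡⟨ cong (bin (a ℕ.+ b) b ℕ.*_) (ℕP.*-comm (b !) (a !)) ⟩
    bin (a ℕ.+ b) b ℕ.* (a ! ℕ.* b !)   ∎)
    where open ≡-Reasoning

  bin-trinomial : ∀ i s t → bin (i ℕ.+ s) i ℕ.* bin (i ℕ.+ s ℕ.+ t) (i ℕ.+ s)
                          ≡ bin (i ℕ.+ s ℕ.+ t) i ℕ.* bin (s ℕ.+ t) s
  bin-trinomial i s t = ℕP.*-cancelʳ-≡ _ _ (i ! ℕ.* s ! ℕ.* t !) {{nonZero}} (begin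
    a ℕ.* b ℕ.* (I ℕ.* S! ℕ.* T!)                 ≡⟨ regroup₁ a b I S! T! ⟩
    a ℕ.* I ℕ.* S! ℕ.* b ℕ.* T!                   ≡⟨ cong (λ z → z ℕ.* b ℕ.* T!) (bin-factorial i s) ⟩
    (i ℕ.+ s) ! ℕ.* b ℕ.* T!                      ≡⟨ cong (ℕ._* T!) (ℕP.*-comm ((i ℕ.+ s) !) b) ⟩
    b ℕ.* (i ℕ.+ s) ! ℕ.* T!                      ≡⟨ bin-factorial (i ℕ.+ s) t ⟩
    (i ℕ.+ s ℕ.+ t) !                             ≡⟨ cong _! (ℕP.+-assoc i s t) ⟩
    (i ℕ.+ (s ℕ.+ t)) !                           ≡⟨ sym (bin-factorial i (s ℕ.+ t)) ⟩
    bin (i ℕ.+ (s ℕ.+ t)) i ℕ.* I ℕ.* (s ℕ.+ t) ! ≡⟨ cong (λ z → bin z i ℕ.* I ℕ.* (s ℕ.+ t) !) (sym (ℕP.+-assoc i s t)) ⟩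
    c ℕ.* I ℕ.* (s ℕ.+ t) !                       ≡⟨ cong (c ℕ.* I ℕ.*_) (sym (bin-factorial s t)) ⟩
    c ℕ.* I ℕ.* (d ℕ.* S! ℕ.* T!)                 ≡⟨ regroup₂ c d I S! T! ⟩
    c ℕ.* d ℕ.* (I ℕ.* S! ℕ.* T!)                 ∎)
    where
    open ≡-Reasoning
    a = bin (i ℕ.+ s) i
    b = bin (i ℕ.+ s ℕ.+ t) (i ℕ.+ s)
    c = bin (i ℕ.+ s ℕ.+ t) i
    d = bin (s ℕ.+ t) s
    I = i !
    S! = s !
    T! = t !
    nonZero : ℕ.NonZero (i ! ℕ.* s ! ℕ.* t !)
    nonZero = ℕP.m*n≢0 (i ! ℕ.* s !) (t !) {{factorials≢0 i s}} {{ℕP._!≢0 t}}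
    regroup₁ : ∀ a b I S T → a ℕ.* b ℕ.* (I ℕ.* S ℕ.* T) ≡ a ℕ.* I ℕ.* S ℕ.* b ℕ.* T
    regroup₁ = ℕSolver.solve-∀
    regroup₂ : ∀ c d I S T → c ℕ.* I ℕ.* (d ℕ.* S ℕ.* T) ≡ c ℕ.* d ℕ.* (I ℕ.* S ℕ.* T)
    regroup₂ = ℕSolver.solve-∀

  -- The same identity for an arbitrary top x ≥ i (both sides vanish when x < i + s).
  bin-revision : ∀ i s x → i ℕ.≤ x → bin (i ℕ.+ s) i ℕ.* bin x (i ℕ.+ s) ≡ bin x i ℕ.* bin (x ∸ i) s
  bin-revision i s x i≤x with i ℕ.+ s ℕ.≤? x
  ... | yes i+s≤x = subst (λ y → bin (i ℕ.+ s) i ℕ.* bin y (i ℕ.+ s) ≡ bin y i ℕ.* bin (y ∸ i) s) x≡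
                      (trans (bin-trinomial i s t) (cong (λ z → bin (i ℕ.+ s ℕ.+ t) i ℕ.* bin z s) s+t≡))
    where
    t = x ∸ (i ℕ.+ s)
    x≡ : i ℕ.+ s ℕ.+ t ≡ x
    x≡ = ℕP.m+[n∸m]≡n i+s≤x
    s+t≡ : s ℕ.+ t ≡ i ℕ.+ s ℕ.+ t ∸ i
    s+t≡ = sym (trans (cong (_∸ i) (ℕP.+-assoc i s t)) (ℕP.m+n∸m≡n i (s ℕ.+ t)))
  ... | no i+s≰x = begin
    bin (i ℕ.+ s) i ℕ.* bin x (i ℕ.+ s) ≡⟨ cong (bin (i ℕ.+ s) i ℕ.*_) (bin-vanish x (i ℕ.+ s) x<i+s) ⟩
    bin (i ℕ.+ s) i ℕ.* 0               ≡⟨ ℕP.*-zeroʳ (bin (i ℕ.+ s) i) ⟩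
    0                                   ≡⟨ sym (ℕP.*-zeroʳ (bin x i)) ⟩
    bin x i ℕ.* 0                       ≡⟨ cong (bin x i ℕ.*_) (sym (bin-vanish (x ∸ i) s x∸i<s)) ⟩
    bin x i ℕ.* bin (x ∸ i) s           ∎
    where
    open ≡-Reasoning
    x<i+s : x ℕ.< i ℕ.+ s
    x<i+s = ℕP.≰⇒> i+s≰x
    x∸i<s : x ∸ i ℕ.< s
    x∸i<s = subst (x ∸ i ℕ.<_) (ℕP.m+n∸m≡n i s) (ℕP.∸-monoˡ-< x<i+s i≤x)

  B : ℕ → ℕ → ℤ
  B n k = + bin n k

  suc-minus-suc : ∀ x r → + suc x - + suc r ≡ + x - + r
  suc-minus-suc x r = trans (cong₂ _-_ (pos-+ 1 x) (pos-+ 1 r)) (cancel (+ x) (+ r))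
    where
    cancel : ∀ a b → (+ 1 + a) - (+ 1 + b) ≡ a - b
    cancel = solve-∀

  absorb-lower : ∀ x r → + suc r * B x (suc r) ≡ (+ x - + r) * B x r
  absorb-lower zero    zero    = refl
  absorb-lower zero    (suc r) = trans (*-zeroʳ (+ suc (suc r))) (sym (*-zeroʳ (+ 0 - + suc r)))
  absorb-lower (suc x) zero    = begin
    + 1 * B (suc x) 1               ≡⟨ *-identityˡ _ ⟩
    B (suc x) 1                     ≡⟨ cong +_ (bin-n1 (suc x)) ⟩
    + suc x                         ≡⟨ times-one (+ suc x) ⟩
    (+ suc x - + 0) * B (suc x) 0   ∎
    where
    open ≡-Reasoning
    times-one : ∀ y → y ≡ (y - + 0) * + 1
    times-one = solve-∀
  absorb-lower (suc x) (suc r) = begin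
    + suc (suc r) * (B x (suc r) + B x (suc (suc r)))
      ≡⟨ *-distribˡ-+ (+ suc (suc r)) (B x (suc r)) _ ⟩
    + suc (suc r) * B x (suc r) + + suc (suc r) * B x (suc (suc r))
      ≡⟨ cong (λ z → + suc (suc r) * B x (suc r) + z) (absorb-lower x (suc r)) ⟩
    + suc (suc r) * B x (suc r) + (+ x - + suc r) * B x (suc r)
      ≡⟨ regroup (+ r) (+ x) (B x (suc r)) ⟩
    (+ 1 + + r) * B x (suc r) + (+ x - + r) * B x (suc r)
      ≡⟨ cong (λ z → z + (+ x - + r) * B x (suc r)) (absorb-lower x r) ⟩
    (+ x - + r) * B x r + (+ x - + r) * B x (suc r)
      ≡⟨ sym (*-distribˡ-+ (+ x - + r) (B x r) _) ⟩
    (+ x - + r) * (B x r + B x (suc r))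
      ≡⟨ cong (_* (B x r + B x (suc r))) (sym (suc-minus-suc x r)) ⟩
    (+ suc x - + suc r) * (B x r + B x (suc r)) ∎
    where
    open ≡-Reasoning
    regroup : ∀ r x b → (+ 1 + (+ 1 + r)) * b + (x - (+ 1 + r)) * b ≡ (+ 1 + r) * b + (x - r) * b
    regroup = solve-∀

  absorb-upper : ∀ n s → + suc s * B (suc n) (suc s) ≡ + suc n * B n s
  absorb-upper zero    zero    = refl
  absorb-upper zero    (suc s) = *-zeroʳ (+ suc (suc s))
  absorb-upper (suc n) zero    = trans (*-identityˡ _) (trans (cong +_ (bin-n1 (suc (suc n)))) (sym (*-identityʳ _)))
  absorb-upper (suc n) (suc s) = begin
    + suc (suc s) * (X + Y)
      ≡⟨ expand (+ s) X Y ⟩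
    X + + suc s * X + + suc (suc s) * Y
      ≡⟨ cong₂ (λ p q → X + p + q) (absorb-upper n s) (absorb-upper n (suc s)) ⟩
    (a + b) + + suc n * a + + suc n * b
      ≡⟨ collect (+ n) a b ⟩
    + suc (suc n) * (a + b) ∎
    where
    open ≡-Reasoning
    X = B (suc n) (suc s)
    Y = B (suc n) (suc (suc s))
    a = B n s
    b = B n (suc s)
    expand : ∀ s X Y → (+ 1 + (+ 1 + s)) * (X + Y) ≡ X + (+ 1 + s) * X + (+ 1 + (+ 1 + s)) * Y
    expand = solve-∀
    collect : ∀ n a b → (a + b) + (+ 1 + n) * a + (+ 1 + n) * b ≡ (+ 1 + (+ 1 + n)) * (a + b)
    collect = solve-∀

  absorb-complement : ∀ j s → (+ suc j - + s) * B (suc j) s ≡ + suc j * B j s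
  absorb-complement j s = trans (sym (absorb-lower (suc j) s)) (absorb-upper j s)

  fall≡ : ∀ x r → fall x r ≡ r ! ℕ.* bin x r
  fall≡ x       zero    = sym (trans (ℕP.*-identityˡ (bin x 0)) (bin-n0 x))
  fall≡ zero    (suc r) = sym (ℕP.*-zeroʳ ((suc r) !))
  fall≡ (suc x) (suc r) = begin
    suc x ℕ.* fall x r                   ≡⟨ cong (suc x ℕ.*_) (fall≡ x r) ⟩
    suc x ℕ.* (r ! ℕ.* bin x r)          ≡⟨ exchange (suc x) (r !) (bin x r) ⟩
    r ! ℕ.* (suc x ℕ.* bin x r)          ≡⟨ cong (r ! ℕ.*_) absorbed ⟩
    r ! ℕ.* (suc r ℕ.* bin (suc x) (suc r)) ≡⟨ exchange (r !) (suc r) _ ⟩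
    suc r ℕ.* (r ! ℕ.* bin (suc x) (suc r)) ≡⟨ sym (ℕP.*-assoc (suc r) (r !) _) ⟩
    (suc r) ! ℕ.* bin (suc x) (suc r)    ∎
    where
    open ≡-Reasoning
    exchange : ∀ a b c → a ℕ.* (b ℕ.* c) ≡ b ℕ.* (a ℕ.* c)
    exchange = ℕSolver.solve-∀
    absorbed : suc x ℕ.* bin x r ≡ suc r ℕ.* bin (suc x) (suc r)
    absorbed = +-injective (trans (pos-* (suc x) (bin x r))
                           (trans (sym (absorb-upper x r)) (sym (pos-* (suc r) (bin (suc x) (suc r))))))

  sign-+ : ∀ a b → sign (a ℕ.+ b) ≡ sign a * sign b
  sign-+ zero    b = sym (*-identityˡ (sign b))
  sign-+ (suc a) b = trans (cong -_ (sign-+ a b)) (neg-distribˡ-* (sign a) (sign b))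

  sign-squared : ∀ a → sign a * sign a ≡ 1ℤ
  sign-squared zero    = refl
  sign-squared (suc a) = trans (neg-squared (sign a)) (sign-squared a)
    where
    neg-squared : ∀ x → - x * - x ≡ x * x
    neg-squared = solve-∀

  sign-cancel : ∀ c j → sign c * sign (c ℕ.+ j) ≡ sign j
  sign-cancel c j = begin
    sign c * sign (c ℕ.+ j)        ≡⟨ cong (sign c *_) (sign-+ c j) ⟩
    sign c * (sign c * sign j)     ≡⟨ sym (*-assoc (sign c) (sign c) (sign j)) ⟩
    sign c * sign c * sign j       ≡⟨ cong (_* sign j) (sign-squared c) ⟩
    1ℤ * sign j                    ≡⟨ *-identityˡ _ ⟩
    sign j                         ∎
    where open ≡-Reasoning

  sign-∸ : ∀ c u → u ℕ.≤ c → sign (c ∸ u) ≡ sign c * sign u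
  sign-∸ c u u≤c = begin
    sign (c ∸ u)                      ≡⟨ sym (sign-cancel u (c ∸ u)) ⟩
    sign u * sign (u ℕ.+ (c ∸ u))     ≡⟨ cong (λ z → sign u * sign z) (ℕP.m+[n∸m]≡n u≤c) ⟩
    sign u * sign c                   ≡⟨ *-comm (sign u) (sign c) ⟩
    sign c * sign u                   ∎
    where open ≡-Reasoning

  sign-reflect : ∀ c j u → u ℕ.≤ c → sign (c ℕ.+ j) * sign (c ∸ u) ≡ sign j * sign u
  sign-reflect c j u u≤c = begin
    sign (c ℕ.+ j) * sign (c ∸ u)         ≡⟨ cong₂ _*_ (sign-+ c j) (sign-∸ c u u≤c) ⟩
    sign c * sign j * (sign c * sign u)   ≡⟨ regroup (sign c) (sign j) (sign u) ⟩
    sign c * sign c * (sign j * sign u)   ≡⟨ cong (_* (sign j * sign u)) (sign-squared c) ⟩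
    1ℤ * (sign j * sign u)                ≡⟨ *-identityˡ _ ⟩
    sign j * sign u                       ∎
    where
    open ≡-Reasoning
    regroup : ∀ a b d → a * b * (a * d) ≡ a * a * (b * d)
    regroup = solve-∀

  S-vanish : ∀ u v → u ℕ.< v → S u v ≡ 0
  S-vanish zero    (suc v) _         = refl
  S-vanish (suc u) (suc v) (s≤s u<v) =
    trans (cong₂ ℕ._+_ (cong (suc v ℕ.*_) (S-vanish u (suc v) (ℕP.m<n⇒m<1+n u<v))) (S-vanish u v u<v))
          (trans (ℕP.+-identityʳ _) (ℕP.*-zeroʳ (suc v)))

  fac : ℕ → ℤ
  fac v = + (v !)

  fac-suc : ∀ v → fac (suc v) ≡ + suc v * fac v
  fac-suc v = pos-* (suc v) (v !)

  times-bin : ∀ x v → + x * B x v ≡ + v * B x v + + suc v * B x (suc v)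
  times-bin x v = trans (split (+ x) (+ v) (B x v)) (cong (λ z → + v * B x v + z) (sym (absorb-lower x v)))
    where
    split : ∀ n v b → n * b ≡ v * b + (n - v) * b
    split = solve-∀

  power-Stirling : ∀ u x → (+ x) ^ u ≡ Σ (suc u) (λ v → + S u v * fac v * B x v)
  power-Stirling zero    x = sym (trans (+-identityʳ _) (trans (*-identityˡ _) (cong +_ (bin-n0 x))))
  power-Stirling (suc u) x = begin
    + x * (+ x) ^ u
      ≡⟨ cong (+ x *_) (power-Stirling u x) ⟩
    + x * Σ (suc u) T
      ≡⟨ sym (Σ-*ˡ (suc u) (+ x) T) ⟩
    Σ (suc u) (λ v → + x * T v)
      ≡⟨ Σ-ext (suc u) (λ v → multiply v) ⟩
    Σ (suc u) (λ v → P v + Q' v)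
      ≡⟨ Σ-+ (suc u) P Q' ⟩
    Σ (suc u) P + Σ (suc u) Q'
      ≡⟨ cong (_+ Σ (suc u) Q') shift ⟩
    Σ (suc u) R + Σ (suc u) Q'
      ≡⟨ sym (Σ-+ (suc u) R Q') ⟩
    Σ (suc u) (λ v → R v + Q' v)
      ≡⟨ Σ-ext (suc u) recombine ⟩
    Σ (suc u) (λ v → T' (suc v))
      ≡⟨ sym (+-identityˡ _) ⟩
    Σ (suc (suc u)) T' ∎
    where
    open ≡-Reasoning
    T T' P Q' R : ℕ → ℤ
    T  v = + S u v * fac v * B x v
    T' v = + S (suc u) v * fac v * B x v
    P  v = + S u v * fac v * (+ v * B x v)
    Q' v = + S u v * fac v * (+ suc v * B x (suc v))
    R  v = + suc v * + S u (suc v) * (+ suc v * fac v) * B x (suc v)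
    multiply : ∀ v → + x * T v ≡ P v + Q' v
    multiply v = trans (exchange (+ x) (+ S u v) (fac v) (B x v))
                       (trans (cong (+ S u v * fac v *_) (times-bin x v)) (distrib (+ S u v) (fac v) _ _))
      where
      exchange : ∀ n a b c → n * (a * b * c) ≡ a * b * (n * c)
      exchange = solve-∀
      distrib : ∀ a b x y → a * b * (x + y) ≡ a * b * x + a * b * y
      distrib = solve-∀
    -- P 0 = 0 and R u = 0 (as S u (suc u) = 0), so Σ P is Σ R shifted by one.
    shift : Σ (suc u) P ≡ Σ (suc u) R
    shift = begin
      Σ (suc u) P        ≡⟨ Σ-shift u P R (λ v _ → trans (cong (λ z → + S u (suc v) * z * (+ suc v * B x (suc v))) (fac-suc v))
                                                          (regroup (+ suc v) (+ S u (suc v)) (fac v) (B x (suc v)))) R-top ⟩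
      P 0 + Σ (suc u) R  ≡⟨ cong (_+ Σ (suc u) R) (at-zero (+ S u 0) (fac 0) (B x 0)) ⟩
      0ℤ + Σ (suc u) R   ≡⟨ +-identityˡ _ ⟩
      Σ (suc u) R        ∎
      where
      at-zero : ∀ a b c → a * b * (+ 0 * c) ≡ 0ℤ
      at-zero = solve-∀
      regroup : ∀ sv a f b → a * (sv * f) * (sv * b) ≡ sv * a * (sv * f) * b
      regroup = solve-∀
      R-top : R u ≡ 0ℤ
      R-top = trans (cong (λ z → + suc u * + z * (+ suc u * fac u) * B x (suc u)) (S-vanish u (suc u) (ℕP.n<1+n u)))
                    (vanish (+ suc u) (+ suc u * fac u) (B x (suc u)))
        where
        vanish : ∀ a f b → a * + 0 * f * b ≡ 0ℤ
        vanish = solve-∀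
    -- Stirling's recurrence S(u+1, v+1) = (v+1) S(u, v+1) + S(u, v).
    recombine : ∀ v → R v + Q' v ≡ T' (suc v)
    recombine v = sym (begin
      + (suc v ℕ.* S u (suc v) ℕ.+ S u v) * fac (suc v) * B x (suc v)
        ≡⟨ cong (λ z → z * fac (suc v) * B x (suc v))
                (trans (pos-+ (suc v ℕ.* S u (suc v)) (S u v)) (cong (_+ + S u v) (pos-* (suc v) (S u (suc v))))) ⟩
      (+ suc v * + S u (suc v) + + S u v) * fac (suc v) * B x (suc v)
        ≡⟨ cong (λ z → (+ suc v * + S u (suc v) + + S u v) * z * B x (suc v)) (fac-suc v) ⟩
      (+ suc v * + S u (suc v) + + S u v) * (+ suc v * fac v) * B x (suc v)
        ≡⟨ distrib (+ suc v) (+ S u (suc v)) (+ S u v) (fac v) (B x (suc v)) ⟩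
      R v + Q' v ∎)
      where
      distrib : ∀ sv a b f c → (sv * a + b) * (sv * f) * c ≡ sv * a * (sv * f) * c + b * f * (sv * c)
      distrib = solve-∀

  shiftedPower-Stirling : ∀ u x → (+ suc x) ^ u ≡ Σ (suc u) (λ v → + S (suc u) (suc v) * fac v * B x v)
  shiftedPower-Stirling u x = *-cancelˡ-≡ (+ suc x) _ _ (begin
    + suc x * (+ suc x) ^ u
      ≡⟨ power-Stirling (suc u) (suc x) ⟩
    Σ (suc (suc u)) (λ v → + S (suc u) v * fac v * B (suc x) v)
      ≡⟨ +-identityˡ _ ⟩
    Σ (suc u) (λ v → + S (suc u) (suc v) * fac (suc v) * B (suc x) (suc v))
      ≡⟨ Σ-ext (suc u) term ⟩
    Σ (suc u) (λ v → + suc x * (+ S (suc u) (suc v) * fac v * B x v))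
      ≡⟨ Σ-*ˡ (suc u) (+ suc x) (λ v → + S (suc u) (suc v) * fac v * B x v) ⟩
    + suc x * Σ (suc u) (λ v → + S (suc u) (suc v) * fac v * B x v) ∎)
    where
    open ≡-Reasoning
    term : ∀ v → + S (suc u) (suc v) * fac (suc v) * B (suc x) (suc v) ≡ + suc x * (+ S (suc u) (suc v) * fac v * B x v)
    term v = begin
      + S (suc u) (suc v) * fac (suc v) * B (suc x) (suc v)
        ≡⟨ cong (λ z → + S (suc u) (suc v) * z * B (suc x) (suc v)) (fac-suc v) ⟩
      + S (suc u) (suc v) * (+ suc v * fac v) * B (suc x) (suc v)
        ≡⟨ regroup₁ (+ S (suc u) (suc v)) (+ suc v) (fac v) (B (suc x) (suc v)) ⟩
      + S (suc u) (suc v) * fac v * (+ suc v * B (suc x) (suc v))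
        ≡⟨ cong (+ S (suc u) (suc v) * fac v *_) (absorb-upper x v) ⟩
      + S (suc u) (suc v) * fac v * (+ suc x * B x v)
        ≡⟨ regroup₂ (+ S (suc u) (suc v)) (fac v) (+ suc x) (B x v) ⟩
      + suc x * (+ S (suc u) (suc v) * fac v * B x v) ∎
      where
      regroup₁ : ∀ a s f b → a * (s * f) * b ≡ a * f * (s * b)
      regroup₁ = solve-∀
      regroup₂ : ∀ a f n b → a * f * (n * b) ≡ n * (a * f * b)
      regroup₂ = solve-∀

  -- binShift i j v = C(i, v-j) for j ≤ v and 0 otherwise; it is the j-th
  -- finite difference of s ↦ C(i+s, v) up to sign.
  binShift : ℕ → ℕ → ℕ → ℕ
  binShift i zero    v       = bin i v
  binShift i (suc j) zero    = 0
  binShift i (suc j) (suc v) = binShift i j v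

  binShift-pascal : ∀ i j v → binShift (suc i) j v ≡ binShift i j v ℕ.+ binShift i (suc j) v
  binShift-pascal i zero    zero    = trans (bin-n0 (suc i)) (cong (ℕ._+ 0) (sym (bin-n0 i)))
  binShift-pascal i zero    (suc v) = ℕP.+-comm (bin i v) (bin i (suc v))
  binShift-pascal i (suc j) zero    = refl
  binShift-pascal i (suc j) (suc v) = binShift-pascal i j v

  binShift-≥ : ∀ i j v → j ℕ.≤ v → binShift i j v ≡ bin i (v ∸ j)
  binShift-≥ i zero    v       _         = refl
  binShift-≥ i (suc j) (suc v) (s≤s j≤v) = binShift-≥ i j v j≤v

  binShift-< : ∀ i j v → v ℕ.< j → binShift i j v ≡ 0
  binShift-< i (suc j) zero    _         = refl
  binShift-< i (suc j) (suc v) (s≤s v<j) = binShift-< i j v v<j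

  finiteDifference-bin : ∀ j i v → Σ (suc j) (λ s → sign s * B j s * B (i ℕ.+ s) v) ≡ sign j * + binShift i j v
  finiteDifference-bin zero i v =
    trans (+-identityʳ _) (trans (*-identityˡ _) (trans (cong (λ z → B z v) (ℕP.+-identityʳ i)) (sym (*-identityˡ _))))
  finiteDifference-bin (suc j) i v = begin
    Σ (suc (suc j)) F
      ≡⟨ cong (λ z → F 0 + z) (Σ-ext (suc j) pascal) ⟩
    F 0 + Σ (suc j) (λ s → - G' s + G (suc s))
      ≡⟨ cong (λ z → F 0 + z) (trans (Σ-+ (suc j) (λ s → - G' s) (λ s → G (suc s))) (cong (_+ Σ (suc j) (λ s → G (suc s))) (Σ-neg (suc j) G'))) ⟩
    F 0 + (- Σ (suc j) G' + Σ (suc j) (λ s → G (suc s)))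
      ≡⟨ reorder (F 0) (Σ (suc j) G') (Σ (suc j) (λ s → G (suc s))) ⟩
    (F 0 + Σ (suc j) (λ s → G (suc s))) - Σ (suc j) G'
      ≡⟨ cong (λ z → (z + Σ (suc j) (λ s → G (suc s))) - Σ (suc j) G') F0≡G0 ⟩
    Σ (suc (suc j)) G - Σ (suc j) G'
      ≡⟨ cong (_- Σ (suc j) G') (trans (Σ-last (suc j) G) (trans (cong (λ z → Σ (suc j) G + z) G-top) (+-identityʳ (Σ (suc j) G)))) ⟩
    Σ (suc j) G - Σ (suc j) G'
      ≡⟨ cong₂ _-_ (finiteDifference-bin j i v)
                   (trans (Σ-ext (suc j) (λ s → cong (λ z → sign s * B j s * B z v) (ℕP.+-suc i s))) (finiteDifference-bin j (suc i) v)) ⟩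
    sign j * + binShift i j v - sign j * + binShift (suc i) j v
      ≡⟨ cong (λ z → sign j * + binShift i j v - sign j * z) (trans (cong +_ (binShift-pascal i j v)) (pos-+ (binShift i j v) (binShift i (suc j) v))) ⟩
    sign j * + binShift i j v - sign j * (+ binShift i j v + + binShift i (suc j) v)
      ≡⟨ cancel (sign j) (+ binShift i j v) (+ binShift i (suc j) v) ⟩
    - sign j * + binShift i (suc j) v ∎
    where
    open ≡-Reasoning
    F G G' : ℕ → ℤ
    F  s = sign s * B (suc j) s * B (i ℕ.+ s) v
    G  s = sign s * B j s * B (i ℕ.+ s) v
    G' s = sign s * B j s * B (i ℕ.+ suc s) v
    -- Pascal's rule on C(j+1, s+1) splits each term of F.
    pascal : ∀ s → F (suc s) ≡ - G' s + G (suc s)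
    pascal s = trans (cong (λ z → - sign s * z * B (i ℕ.+ suc s) v) (pos-+ (bin j s) (bin j (suc s))))
                     (distrib (sign s) (B j s) (B j (suc s)) (B (i ℕ.+ suc s) v))
      where
      distrib : ∀ g a b c → - g * (a + b) * c ≡ - (g * a * c) + - g * b * c
      distrib = solve-∀
    G-top : G (suc j) ≡ 0ℤ
    G-top = trans (cong (λ z → sign (suc j) * + z * B (i ℕ.+ suc j) v) (bin-vanish j (suc j) (ℕP.n<1+n j)))
                  (vanish (sign (suc j)) (B (i ℕ.+ suc j) v))
      where
      vanish : ∀ a b → a * + 0 * b ≡ 0ℤ
      vanish = solve-∀
    F0≡G0 : F 0 ≡ G 0
    F0≡G0 = cong (λ z → 1ℤ * + z * B (i ℕ.+ 0) v) (sym (bin-n0 j))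
    reorder : ∀ g a b → g + (- a + b) ≡ (g + b) - a
    reorder = solve-∀
    cancel : ∀ g x y → g * x - g * (x + y) ≡ - g * y
    cancel = solve-∀

  finiteDifference-expansion : ∀ j i u (c f : ℕ → ℤ) → (∀ x → f x ≡ Σ (suc u) (λ v → c v * B x v)) →
    Σ (suc j) (λ s → sign s * B j s * f (i ℕ.+ s)) ≡ sign j * Σ (suc u) (λ v → c v * + binShift i j v)
  finiteDifference-expansion j i u c f expansion = begin
    Σ (suc j) (λ s → sign s * B j s * f (i ℕ.+ s))
      ≡⟨ Σ-ext (suc j) (λ s → cong (sign s * B j s *_) (expansion (i ℕ.+ s))) ⟩
    Σ (suc j) (λ s → sign s * B j s * Σ (suc u) (λ v → c v * B (i ℕ.+ s) v))
      ≡⟨ Σ-swap-scaled (suc j) (suc u) (λ s → sign s * B j s) c (λ s v → B (i ℕ.+ s) v) ⟩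
    Σ (suc u) (λ v → c v * Σ (suc j) (λ s → sign s * B j s * B (i ℕ.+ s) v))
      ≡⟨ Σ-ext (suc u) (λ v → cong (c v *_) (finiteDifference-bin j i v)) ⟩
    Σ (suc u) (λ v → c v * (sign j * + binShift i j v))
      ≡⟨ Σ-ext (suc u) (λ v → exchange (c v) (sign j) (+ binShift i j v)) ⟩
    Σ (suc u) (λ v → sign j * (c v * + binShift i j v))
      ≡⟨ Σ-*ˡ (suc u) (sign j) (λ v → c v * + binShift i j v) ⟩
    sign j * Σ (suc u) (λ v → c v * + binShift i j v) ∎
    where
    open ≡-Reasoning
    exchange : ∀ c g d → c * (g * d) ≡ g * (c * d)
    exchange = solve-∀

  neg-pow : ∀ (x : ℤ) w → (- x) ^ w ≡ sign w * x ^ w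
  neg-pow x zero    = refl
  neg-pow x (suc w) = trans (cong (- x *_) (neg-pow x w)) (regroup x (sign w) (x ^ w))
    where
    regroup : ∀ x s p → - x * (s * p) ≡ - s * (x * p)
    regroup = solve-∀

  pos-pow : ∀ a n → + (a ℕ.^ n) ≡ (+ a) ^ n
  pos-pow a zero    = refl
  pos-pow a (suc n) = trans (pos-* a (a ℕ.^ n)) (cong (+ a *_) (pos-pow a n))

  binomialTheorem : ∀ n (a b : ℤ) → (a + b) ^ n ≡ Σ (suc n) (λ w → B n w * a ^ (n ∸ w) * b ^ w)
  binomialTheorem zero    a b = refl
  binomialTheorem (suc n) a b = begin
    (a + b) * (a + b) ^ n
      ≡⟨ cong ((a + b) *_) (binomialTheorem n a b) ⟩
    (a + b) * Σ (suc n) U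
      ≡⟨ *-distribʳ-+ (Σ (suc n) U) a b ⟩
    a * Σ (suc n) U + b * Σ (suc n) U
      ≡⟨ cong₂ _+_ (sym (Σ-*ˡ (suc n) a U)) (sym (Σ-*ˡ (suc n) b U)) ⟩
    Σ (suc n) (λ w → a * U w) + Σ (suc n) (λ w → b * U w)
      ≡⟨ cong (_+ Σ (suc n) (λ w → b * U w)) times-a ⟩
    (V 0 + Σ (suc n) W) + Σ (suc n) (λ w → b * U w)
      ≡⟨ reorder (V 0) (Σ (suc n) W) (Σ (suc n) (λ w → b * U w)) ⟩
    V 0 + (Σ (suc n) (λ w → b * U w) + Σ (suc n) W)
      ≡⟨ cong (λ z → V 0 + z) (sym (Σ-+ (suc n) (λ w → b * U w) W)) ⟩
    V 0 + Σ (suc n) (λ w → b * U w + W w)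
      ≡⟨ cong (λ z → V 0 + z) (Σ-ext (suc n) pascal) ⟩
    V 0 + Σ (suc n) (λ w → V (suc w)) ∎
    where
    open ≡-Reasoning
    U V W : ℕ → ℤ
    U w = B n w * a ^ (n ∸ w) * b ^ w
    V w = B (suc n) w * a ^ (suc n ∸ w) * b ^ w
    W w = B n (suc w) * a ^ (n ∸ w) * b ^ (suc w)
    reorder : ∀ x y z → (x + y) + z ≡ x + (z + y)
    reorder = solve-∀
    pascal : ∀ w → b * U w + W w ≡ V (suc w)
    pascal w = trans (collect b (B n w) (B n (suc w)) (a ^ (n ∸ w)) (b ^ w))
                     (cong (λ z → z * a ^ (n ∸ w) * (b * b ^ w)) (sym (pos-+ (bin n w) (bin n (suc w)))))
      where
      collect : ∀ b x y p q → b * (x * p * q) + y * p * (b * q) ≡ (x + y) * p * (b * q)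
      collect = solve-∀
    -- Multiplying by a raises the power of a; the top term W n vanishes.
    times-a : Σ (suc n) (λ w → a * U w) ≡ V 0 + Σ (suc n) W
    times-a = trans (Σ-shift n (λ w → a * U w) W rest W-top) (cong (_+ Σ (suc n) W) first)
      where
      first : a * U 0 ≡ V 0
      first = trans (cong (λ z → a * (+ z * a ^ n * 1ℤ)) (bin-n0 n)) (regroup a (a ^ n))
        where
        regroup : ∀ a p → a * (+ 1 * p * + 1) ≡ + 1 * (a * p) * + 1
        regroup = solve-∀
      rest : ∀ w → w ℕ.< n → a * U (suc w) ≡ W w
      rest w w<n = trans (regroup a (B n (suc w)) (a ^ (n ∸ suc w)) (b ^ suc w))
                         (cong (λ z → B n (suc w) * a ^ z * b ^ suc w) (sym (∸-suc n w w<n)))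
        where
        regroup : ∀ a x p q → a * (x * p * q) ≡ x * (a * p) * q
        regroup = solve-∀
      W-top : W n ≡ 0ℤ
      W-top = trans (cong (λ z → + z * a ^ (n ∸ n) * b ^ suc n) (bin-vanish n (suc n) (ℕP.n<1+n n)))
                    (trans (cong (_* b ^ suc n) (*-zeroˡ (a ^ (n ∸ n)))) (*-zeroˡ (b ^ suc n)))

  prodDiff : ∀ {c} → Vec ℕ c → ℕ → ℤ
  prodDiff []       r = 1ℤ
  prodDiff (k ∷ ks) r = (+ k - + r) * prodDiff ks r

  denomQ≡ : ∀ {c} (ks : Vec ℕ c) i → denomQ ks i ≡ sign c * prodDiff ks i
  denomQ≡ []               i = refl
  denomQ≡ {suc c} (k ∷ ks) i = trans (cong ((+ i - + k) *_) (denomQ≡ ks i)) (flip (+ i) (+ k) (sign c) (prodDiff ks i))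
    where
    flip : ∀ i k s p → (i - k) * (s * p) ≡ - s * ((k - i) * p)
    flip = solve-∀

  esym-0 : ∀ {c} (ks : Vec ℕ c) → esym 0 ks ≡ 1ℤ
  esym-0 []       = refl
  esym-0 (k ∷ ks) = refl

  esym-vanish : ∀ {c} (ks : Vec ℕ c) s → c ℕ.< s → esym s ks ≡ 0ℤ
  esym-vanish []       (suc s) _         = refl
  esym-vanish (k ∷ ks) (suc s) (s≤s c<s) =
    trans (cong₂ _+_ (esym-vanish ks (suc s) (ℕP.m<n⇒m<1+n c<s)) (cong (+ k *_) (esym-vanish ks s c<s)))
          (trans (+-identityˡ _) (*-zeroʳ (+ k)))

  prodDiff-esym : ∀ {c} (ks : Vec ℕ c) r → prodDiff ks r ≡ Σ (suc c) (λ t → esym t ks * (- + r) ^ (c ∸ t))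
  prodDiff-esym []               r = refl
  prodDiff-esym {suc c} (k ∷ ks) r = begin
    (+ k - + r) * prodDiff ks r
      ≡⟨ cong ((+ k - + r) *_) (prodDiff-esym ks r) ⟩
    (+ k - + r) * Σ (suc c) T
      ≡⟨ split (+ k) (+ r) (Σ (suc c) T) ⟩
    - + r * Σ (suc c) T + + k * Σ (suc c) T
      ≡⟨ cong₂ _+_ (sym (Σ-*ˡ (suc c) (- + r) T)) (sym (Σ-*ˡ (suc c) (+ k) T)) ⟩
    Σ (suc c) (λ t → - + r * T t) + Σ (suc c) (λ t → + k * T t)
      ≡⟨ cong (_+ Σ (suc c) (λ t → + k * T t)) times-y ⟩
    (T' 0 + Σ (suc c) T₊) + Σ (suc c) (λ t → + k * T t)
      ≡⟨ +-assoc (T' 0) _ _ ⟩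
    T' 0 + (Σ (suc c) T₊ + Σ (suc c) (λ t → + k * T t))
      ≡⟨ cong (λ z → T' 0 + z) (sym (Σ-+ (suc c) T₊ (λ t → + k * T t))) ⟩
    T' 0 + Σ (suc c) (λ t → T₊ t + + k * T t)
      ≡⟨ cong (λ z → T' 0 + z) (Σ-ext (suc c) (λ t → collect (esym (suc t) ks) (+ k) (esym t ks) ((- + r) ^ (c ∸ t)))) ⟩
    T' 0 + Σ (suc c) (λ t → T' (suc t)) ∎
    where
    open ≡-Reasoning
    T T' T₊ : ℕ → ℤ
    T  t = esym t ks * (- + r) ^ (c ∸ t)
    T' t = esym t (k ∷ ks) * (- + r) ^ (suc c ∸ t)
    T₊ t = esym (suc t) ks * (- + r) ^ (c ∸ t)
    split : ∀ k r x → (k - r) * x ≡ - r * x + k * x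
    split = solve-∀
    collect : ∀ e k e' p → e * p + k * (e' * p) ≡ (e + k * e') * p
    collect = solve-∀
    -- Multiplying by y raises the power of y; e_{c+1}(ks) = 0 kills the top term.
    times-y : Σ (suc c) (λ t → - + r * T t) ≡ T' 0 + Σ (suc c) T₊
    times-y = trans (Σ-shift c (λ t → - + r * T t) T₊ rest top) (cong (_+ Σ (suc c) T₊) first)
      where
      first : - + r * T 0 ≡ T' 0
      first = trans (cong (λ z → - + r * (z * (- + r) ^ c)) (esym-0 ks)) (regroup (- + r) ((- + r) ^ c))
        where
        regroup : ∀ x p → x * (+ 1 * p) ≡ + 1 * (x * p)
        regroup = solve-∀
      rest : ∀ t → t ℕ.< c → - + r * T (suc t) ≡ T₊ t
      rest t t<c = trans (exchange (- + r) (esym (suc t) ks) ((- + r) ^ (c ∸ suc t)))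
                         (cong (λ z → esym (suc t) ks * (- + r) ^ z) (sym (∸-suc c t t<c)))
        where
        exchange : ∀ x e q → x * (e * q) ≡ e * (x * q)
        exchange = solve-∀
      top : T₊ c ≡ 0ℤ
      top = trans (cong (_* (- + r) ^ (c ∸ c)) (esym-vanish ks (suc c) (ℕP.n<1+n c))) (*-zeroˡ ((- + r) ^ (c ∸ c)))

  prodDiff-expansion : ∀ {c} (ks : Vec ℕ c) r → prodDiff ks r ≡ Σ (suc c) (λ u → sign u * esym (c ∸ u) ks * (+ r) ^ u)
  prodDiff-expansion {c} ks r = begin
    prodDiff ks r
      ≡⟨ prodDiff-esym ks r ⟩
    Σ (suc c) (λ t → esym t ks * (- + r) ^ (c ∸ t))
      ≡⟨ Σ-reverse c (λ t → esym t ks * (- + r) ^ (c ∸ t)) ⟩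
    Σ (suc c) (λ u → esym (c ∸ u) ks * (- + r) ^ (c ∸ (c ∸ u)))
      ≡⟨ Σ-cong (suc c) (λ u u≤c → trans (cong (λ z → esym (c ∸ u) ks * (- + r) ^ z) (ℕP.m∸[m∸n]≡n (ℕP.≤-pred u≤c)))
                                          (trans (cong (esym (c ∸ u) ks *_) (neg-pow (+ r) u)) (regroup (esym (c ∸ u) ks) (sign u) ((+ r) ^ u)))) ⟩
    Σ (suc c) (λ u → sign u * esym (c ∸ u) ks * (+ r) ^ u) ∎
    where
    open ≡-Reasoning
    regroup : ∀ e s p → e * (s * p) ≡ s * e * p
    regroup = solve-∀

  finiteDifference-power : ∀ j i u →
    Σ (suc j) (λ s → sign s * B j s * (+ (i ℕ.+ s)) ^ u) ≡ sign j * Σ (suc u) (λ v → + S u v * fac v * + binShift i j v)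
  finiteDifference-power j i u = finiteDifference-expansion j i u (λ v → + S u v * fac v) (λ x → (+ x) ^ u) (power-Stirling u)

  finiteDifference-shiftedPower : ∀ j i u →
    Σ (suc j) (λ s → sign s * B j s * (+ suc (i ℕ.+ s)) ^ u)
      ≡ sign j * Σ (suc u) (λ v → + S (suc u) (suc v) * fac v * + binShift i j v)
  finiteDifference-shiftedPower j i u =
    finiteDifference-expansion j i u (λ v → + S (suc u) (suc v) * fac v) (λ x → (+ suc x) ^ u) (shiftedPower-Stirling u)

  module NumeratorQ (m c' : ℕ) (ks : Vec ℕ (suc c')) (i j' : ℕ) where
    c = suc c'
    j = suc j'

    E J σ σ′ A : ℕ → ℤ
    E  u = esym (c ∸ u) ks
    J  u = + suc j' * B c' (u ∸ 1) * (+ suc m) ^ (c ∸ u)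
    σ  u = Σ (suc u) (λ v → + S u v * fac v * + binShift i j v)
    σ′ w = Σ (suc w) (λ v → + S (suc w) (suc v) * fac v * + binShift i j' v)
    A  u = Σ (suc u) (λ v → + S u v * + binShift i j v * fac (v ∸ 1))

    N₁ N₂ : ℤ
    N₁ = Σ c (λ w → sign (c' ∸ w) * (+ suc j' * B c' w * (+ suc m) ^ (c' ∸ w) * σ′ w))
    N₂ = Σ (suc c) (λ u → sign (c ∸ u) * (E u * σ u))

    summand term : ℕ → ℕ → ℤ
    summand u v = (+ (S u v ℕ.* (i C (v ∸ j)) ℕ.* ((v ∸ 1) ℕ.!)))
                * ((+ (j ℕ.* ((c ∸ 1) C (u ∸ 1)) ℕ.* ((m ℕ.+ 1) ℕ.^ (c ∸ u)))) - (+ v) * esym (c ∸ u) ks)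
    term u v = + S u v * + binShift i j v * fac (v ∸ 1) * (J u - + v * E u)

    summand≡term : ∀ u v → j ℕ.≤ v → summand u v ≡ term u v
    summand≡term u v j≤v = cong₂ (λ a b → a * (b - + v * E u)) coefficient power
      where
      coefficient : + (S u v ℕ.* (i C (v ∸ j)) ℕ.* ((v ∸ 1) ℕ.!)) ≡ + S u v * + binShift i j v * fac (v ∸ 1)
      coefficient = trans (pos-* (S u v ℕ.* (i C (v ∸ j))) ((v ∸ 1) !))
        (cong (_* fac (v ∸ 1)) (trans (pos-* (S u v) (i C (v ∸ j)))
          (cong (λ z → + S u v * + z) (trans (sym (bin≡C i (v ∸ j))) (sym (binShift-≥ i j v j≤v))))))
      power : + (j ℕ.* ((c ∸ 1) C (u ∸ 1)) ℕ.* ((m ℕ.+ 1) ℕ.^ (c ∸ u))) ≡ J u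
      power = trans (pos-* (j ℕ.* (c' C (u ∸ 1))) ((m ℕ.+ 1) ℕ.^ (c ∸ u)))
        (cong₂ _*_ (trans (pos-* j (c' C (u ∸ 1))) (cong (λ z → + suc j' * + z) (sym (bin≡C c' (u ∸ 1)))))
                   (trans (pos-pow (m ℕ.+ 1) (c ∸ u)) (cong (λ z → (+ z) ^ (c ∸ u)) (ℕP.+-comm m 1))))

    term-< : ∀ u v → v ℕ.< j → term u v ≡ 0ℤ
    term-< u v v<j = trans (cong (λ z → + S u v * + z * fac (v ∸ 1) * (J u - + v * E u)) (binShift-< i j v v<j))
                           (vanish (+ S u v) (fac (v ∸ 1)) (J u - + v * E u))
      where
      vanish : ∀ a b d → a * + 0 * b * d ≡ 0ℤ
      vanish = solve-∀

    rowSum : ℕ → ℤ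
    rowSum u = sign (c ∸ u) * Σ (suc u) (term u)

    numQ-full : numQ m ks i j ≡ Σ (suc c) rowSum
    numQ-full = sumℤ-range-padded j c (λ u → sign (c ∸ u) * sumℤ (map (summand u) (range j u))) rowSum
      (λ u _ → cong (sign (c ∸ u) *_) (sumℤ-range-padded j u (summand u) (term u) (summand≡term u) (term-< u)))
      (λ u u<j → trans (cong (sign (c ∸ u) *_) (Σ-zero (suc u) (λ v v≤u → term-< u v (ℕP.<-≤-trans v≤u u<j))))
                       (*-zeroʳ (sign (c ∸ u))))

    times-fac-pred : ∀ u v → + S u v * + binShift i j v * (+ v * fac (v ∸ 1)) ≡ + S u v * fac v * + binShift i j v
    times-fac-pred u zero    = vanish (+ S u 0)
      where
      vanish : ∀ a → a * + 0 * (+ 0 * + 1) ≡ a * + 1 * + 0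
      vanish = solve-∀
    times-fac-pred u (suc v) = trans (regroup (+ S u (suc v)) (+ binShift i j (suc v)) (+ suc v) (fac v))
                                     (cong (λ z → + S u (suc v) * z * + binShift i j (suc v)) (sym (fac-suc v)))
      where
      regroup : ∀ a d s f → a * d * (s * f) ≡ a * (s * f) * d
      regroup = solve-∀

    rowSum-split : ∀ u → Σ (suc u) (term u) ≡ J u * A u - E u * σ u
    rowSum-split u = begin
      Σ (suc u) (term u)
        ≡⟨ Σ-ext (suc u) (λ v → distrib (+ S u v) (+ binShift i j v) (fac (v ∸ 1)) (J u) (+ v) (E u)) ⟩
      Σ (suc u) (λ v → J u * a v + - (E u * a′ v))
        ≡⟨ Σ-+ (suc u) (λ v → J u * a v) (λ v → - (E u * a′ v)) ⟩
      Σ (suc u) (λ v → J u * a v) + Σ (suc u) (λ v → - (E u * a′ v))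
        ≡⟨ cong₂ _+_ (Σ-*ˡ (suc u) (J u) a)
                     (trans (Σ-neg (suc u) (λ v → E u * a′ v))
                            (cong -_ (trans (Σ-*ˡ (suc u) (E u) a′) (cong (E u *_) (Σ-ext (suc u) (times-fac-pred u)))))) ⟩
      J u * A u - E u * σ u ∎
      where
      open ≡-Reasoning
      a a′ : ℕ → ℤ
      a  v = + S u v * + binShift i j v * fac (v ∸ 1)
      a′ v = + S u v * + binShift i j v * (+ v * fac (v ∸ 1))
      distrib : ∀ s d f J v e → s * d * f * (J - v * e) ≡ J * (s * d * f) + - (e * (s * d * (v * f)))
      distrib = solve-∀

    A-suc : ∀ w → A (suc w) ≡ σ′ w
    A-suc w = trans (+-identityˡ _) (Σ-ext (suc w) (λ v → exchange (+ S (suc w) (suc v)) (+ binShift i j' v) (fac v)))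
      where
      exchange : ∀ a d f → a * d * f ≡ a * f * d
      exchange = solve-∀

    numQ-split : numQ m ks i j ≡ N₁ - N₂
    numQ-split = begin
      numQ m ks i j
        ≡⟨ numQ-full ⟩
      Σ (suc c) rowSum
        ≡⟨ Σ-ext (suc c) (λ u → trans (cong (sign (c ∸ u) *_) (rowSum-split u)) (distrib (sign (c ∸ u)) (J u) (A u) (E u) (σ u))) ⟩
      Σ (suc c) (λ u → sign (c ∸ u) * J u * A u + - (sign (c ∸ u) * (E u * σ u)))
        ≡⟨ Σ-+ (suc c) (λ u → sign (c ∸ u) * J u * A u) (λ u → - (sign (c ∸ u) * (E u * σ u))) ⟩
      Σ (suc c) (λ u → sign (c ∸ u) * J u * A u) + Σ (suc c) (λ u → - (sign (c ∸ u) * (E u * σ u)))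
        ≡⟨ cong₂ _+_ first (Σ-neg (suc c) (λ u → sign (c ∸ u) * (E u * σ u))) ⟩
      N₁ - N₂ ∎
      where
      open ≡-Reasoning
      distrib : ∀ s J A e n → s * (J * A - e * n) ≡ s * J * A + - (s * (e * n))
      distrib = solve-∀
      -- The u = 0 term vanishes since A 0 = 0.
      first : Σ (suc c) (λ u → sign (c ∸ u) * J u * A u) ≡ N₁
      first = trans (cong (_+ Σ c (λ w → sign (c ∸ suc w) * J (suc w) * A (suc w))) (*-zeroʳ (sign c * J 0)))
                (trans (+-identityˡ _) (Σ-ext c (λ w → trans (cong (λ z → sign (c' ∸ w) * J (suc w) * z) (A-suc w))
                   (*-assoc (sign (c' ∸ w)) (J (suc w)) (σ′ w)))))

    -- For j ≥ c every term of numQ vanishes: only (u, v) = (c, c) survives the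
    -- support condition v ≥ j, and there J c = c = c · e₀.
    numQ-vanish : c' ℕ.≤ j' → numQ m ks i j ≡ 0ℤ
    numQ-vanish c'≤j' = begin
      numQ m ks i j                ≡⟨ numQ-full ⟩
      Σ (suc c) rowSum             ≡⟨ Σ-last c rowSum ⟩
      Σ c rowSum + rowSum c        ≡⟨ cong₂ _+_ lower-rows top-row ⟩
      0ℤ                           ∎
      where
      open ≡-Reasoning
      lower-rows : Σ c rowSum ≡ 0ℤ
      lower-rows = Σ-zero c (λ u u<c → trans (cong (sign (c ∸ u) *_)
        (Σ-zero (suc u) (λ v v≤u → term-< u v (ℕP.<-≤-trans v≤u (ℕP.≤-trans u<c (s≤s c'≤j'))))))
        (*-zeroʳ (sign (c ∸ u))))
      corner : term c c ≡ 0ℤ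
      corner with c' ℕ.≟ j'
      ... | no c'≢j'  = term-< c c (s≤s (ℕP.≤∧≢⇒< c'≤j' c'≢j'))
      ... | yes refl = trans (cong (λ z → + S c c * + binShift i c c * fac c' * z) bracket)
                             (*-zeroʳ (+ S c c * + binShift i c c * fac c'))
        where
        bracket : J c - + c * E c ≡ 0ℤ
        bracket = begin
          + suc c' * B c' c' * (+ suc m) ^ (c ∸ c) - + c * esym (c ∸ c) ks
            ≡⟨ cong₂ (λ a n → + suc c' * + a * (+ suc m) ^ n - + c * esym n ks) (bin-nn c') (ℕP.n∸n≡0 c) ⟩
          + suc c' * + 1 * + 1 - + c * esym 0 ks
            ≡⟨ cong (λ z → + suc c' * + 1 * + 1 - + c * z) (esym-0 ks) ⟩
          + suc c' * + 1 * + 1 - + c * + 1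
            ≡⟨ cancel (+ suc c') ⟩
          0ℤ ∎
          where
          cancel : ∀ a → a * + 1 * + 1 - a * + 1 ≡ 0ℤ
          cancel = solve-∀
      top-row : rowSum c ≡ 0ℤ
      top-row = trans (cong (sign (c ∸ c) *_)
        (trans (Σ-last c (term c))
               (trans (cong₂ _+_ (Σ-zero c (λ v v<c → term-< c v (ℕP.<-≤-trans v<c (s≤s c'≤j')))) corner) refl)))
        (*-zeroʳ (sign (c ∸ c)))

  h : ℕ → ∀ {c'} → Vec ℕ (suc c') → ℕ → ℕ → ℤ
  h m {c'} ks r x = (+ x - + r) * (+ m - + r) ^ c' - prodDiff ks r

  Δh : ℕ → ∀ {c'} → Vec ℕ (suc c') → ℕ → ℕ → ℤ
  Δh m ks i j = Σ (suc j) (λ s → sign s * B j s * h m ks (i ℕ.+ s) (i ℕ.+ j))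

  -- For j ≥ 1 the difference is the numerator of Q up to sign:
  -- Δh(i, j) = (-1)^(c+j) numQ(i, j).  Both parts of h are expanded in
  -- Stirling numbers; the first gives N₁, the second N₂.
  module DifferenceOfH (m c' : ℕ) (ks : Vec ℕ (suc c')) (i j' : ℕ) where
    open NumeratorQ m c' ks i j'

    Y : ℕ → ℤ
    Y s = (+ m - + (i ℕ.+ s)) ^ c'

    ΔY ΔP : ℤ
    ΔY = Σ (suc j) (λ s → sign s * B j s * ((+ j - + s) * Y s))
    ΔP = Σ (suc j) (λ s → sign s * B j s * prodDiff ks (i ℕ.+ s))

    Δh-split : Δh m ks i j ≡ ΔY - ΔP
    Δh-split = begin
      Δh m ks i j
        ≡⟨ Σ-ext (suc j) (λ s → trans (cong (λ z → sign s * B j s * (z * Y s - prodDiff ks (i ℕ.+ s))) (difference s))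
                                       (distrib (sign s * B j s) (+ j - + s) (Y s) (prodDiff ks (i ℕ.+ s)))) ⟩
      Σ (suc j) (λ s → sign s * B j s * ((+ j - + s) * Y s) + - (sign s * B j s * prodDiff ks (i ℕ.+ s)))
        ≡⟨ Σ-+ (suc j) (λ s → sign s * B j s * ((+ j - + s) * Y s)) (λ s → - (sign s * B j s * prodDiff ks (i ℕ.+ s))) ⟩
      ΔY + Σ (suc j) (λ s → - (sign s * B j s * prodDiff ks (i ℕ.+ s)))
        ≡⟨ cong (λ z → ΔY + z) (Σ-neg (suc j) (λ s → sign s * B j s * prodDiff ks (i ℕ.+ s))) ⟩
      ΔY - ΔP ∎
      where
      open ≡-Reasoning
      difference : ∀ s → + (i ℕ.+ j) - + (i ℕ.+ s) ≡ + j - + s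
      difference s = trans (cong₂ _-_ (pos-+ i j) (pos-+ i s)) (cancel (+ i) (+ j) (+ s))
        where
        cancel : ∀ i j s → (i + j) - (i + s) ≡ j - s
        cancel = solve-∀
      distrib : ∀ g d y p → g * (d * y - p) ≡ g * (d * y) + - (g * p)
      distrib = solve-∀

    -- (j - s) C(j, s) = j C(j-1, s) turns ΔY into a (j-1)-th difference.
    ΔY-absorb : ΔY ≡ + suc j' * Σ (suc j') (λ s → sign s * B j' s * Y s)
    ΔY-absorb = begin
      ΔY
        ≡⟨ Σ-ext (suc j) absorb ⟩
      Σ (suc (suc j')) Z
        ≡⟨ Σ-last (suc j') Z ⟩
      Σ (suc j') Z + Z (suc j')
        ≡⟨ cong (λ z → Σ (suc j') Z + z) Z-top ⟩
      Σ (suc j') Z + 0ℤ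
        ≡⟨ +-identityʳ _ ⟩
      Σ (suc j') Z
        ≡⟨ Σ-*ˡ (suc j') (+ suc j') (λ s → sign s * B j' s * Y s) ⟩
      + suc j' * Σ (suc j') (λ s → sign s * B j' s * Y s) ∎
      where
      open ≡-Reasoning
      Z : ℕ → ℤ
      Z s = + suc j' * (sign s * B j' s * Y s)
      absorb : ∀ s → sign s * B j s * ((+ j - + s) * Y s) ≡ Z s
      absorb s = trans (regroup₁ (sign s) (B j s) (+ j - + s) (Y s))
                       (trans (cong (λ z → sign s * z * Y s) (absorb-complement j' s)) (regroup₂ (sign s) (+ suc j') (B j' s) (Y s)))
        where
        regroup₁ : ∀ g b d y → g * b * (d * y) ≡ g * (d * b) * y
        regroup₁ = solve-∀
        regroup₂ : ∀ g a b y → g * (a * b) * y ≡ a * (g * b * y)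
        regroup₂ = solve-∀
      Z-top : Z (suc j') ≡ 0ℤ
      Z-top = trans (cong (λ z → + suc j' * (sign (suc j') * + z * Y (suc j'))) (bin-vanish j' (suc j') (ℕP.n<1+n j')))
                    (vanish (+ suc j') (sign (suc j')) (Y (suc j')))
        where
        vanish : ∀ a g y → a * (g * + 0 * y) ≡ 0ℤ
        vanish = solve-∀

    -- (m - (i+s))^(c-1) = ((m+1) - (i+s+1))^(c-1), expanded binomially.
    Y-expansion : ∀ s → Y s ≡ Σ (suc c') (λ w → B c' w * (+ suc m) ^ (c' ∸ w) * (sign w * (+ suc (i ℕ.+ s)) ^ w))
    Y-expansion s = begin
      (+ m - + (i ℕ.+ s)) ^ c'
        ≡⟨ cong (_^ c') (sym (suc-minus-suc m (i ℕ.+ s))) ⟩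
      (+ suc m + - + suc (i ℕ.+ s)) ^ c'
        ≡⟨ binomialTheorem c' (+ suc m) (- + suc (i ℕ.+ s)) ⟩
      Σ (suc c') (λ w → B c' w * (+ suc m) ^ (c' ∸ w) * (- + suc (i ℕ.+ s)) ^ w)
        ≡⟨ Σ-ext (suc c') (λ w → cong (B c' w * (+ suc m) ^ (c' ∸ w) *_) (neg-pow (+ suc (i ℕ.+ s)) w)) ⟩
      Σ (suc c') (λ w → B c' w * (+ suc m) ^ (c' ∸ w) * (sign w * (+ suc (i ℕ.+ s)) ^ w)) ∎
      where open ≡-Reasoning

    ΔY-Stirling : Σ (suc j') (λ s → sign s * B j' s * Y s)
                ≡ sign j' * Σ c (λ w → B c' w * (+ suc m) ^ (c' ∸ w) * (sign w * σ′ w))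
    ΔY-Stirling = begin
      Σ (suc j') (λ s → sign s * B j' s * Y s)
        ≡⟨ Σ-ext (suc j') (λ s → cong (sign s * B j' s *_) (Y-expansion s)) ⟩
      Σ (suc j') (λ s → sign s * B j' s * Σ (suc c') (λ w → β w * (sign w * (+ suc (i ℕ.+ s)) ^ w)))
        ≡⟨ Σ-swap-scaled (suc j') (suc c') (λ s → sign s * B j' s) β (λ s w → sign w * (+ suc (i ℕ.+ s)) ^ w) ⟩
      Σ (suc c') (λ w → β w * Σ (suc j') (λ s → sign s * B j' s * (sign w * (+ suc (i ℕ.+ s)) ^ w)))
        ≡⟨ Σ-ext (suc c') (λ w → cong (β w *_) (difference w)) ⟩
      Σ (suc c') (λ w → β w * (sign w * (sign j' * σ′ w)))
        ≡⟨ Σ-ext (suc c') (λ w → regroup (β w) (sign w) (sign j') (σ′ w)) ⟩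
      Σ (suc c') (λ w → sign j' * (β w * (sign w * σ′ w)))
        ≡⟨ Σ-*ˡ (suc c') (sign j') (λ w → β w * (sign w * σ′ w)) ⟩
      sign j' * Σ c (λ w → β w * (sign w * σ′ w)) ∎
      where
      open ≡-Reasoning
      β : ℕ → ℤ
      β w = B c' w * (+ suc m) ^ (c' ∸ w)
      regroup : ∀ b g s n → b * (g * (s * n)) ≡ s * (b * (g * n))
      regroup = solve-∀
      difference : ∀ w → Σ (suc j') (λ s → sign s * B j' s * (sign w * (+ suc (i ℕ.+ s)) ^ w)) ≡ sign w * (sign j' * σ′ w)
      difference w = trans (Σ-ext (suc j') (λ s → exchange (sign s * B j' s) (sign w) ((+ suc (i ℕ.+ s)) ^ w)))
                           (trans (Σ-*ˡ (suc j') (sign w) (λ s → sign s * B j' s * (+ suc (i ℕ.+ s)) ^ w))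
                                  (cong (sign w *_) (finiteDifference-shiftedPower j' i w)))
        where
        exchange : ∀ a g p → a * (g * p) ≡ g * (a * p)
        exchange = solve-∀

    ΔP-Stirling : ΔP ≡ Σ (suc c) (λ u → sign u * E u * (sign j * σ u))
    ΔP-Stirling = begin
      ΔP
        ≡⟨ Σ-ext (suc j) (λ s → cong (sign s * B j s *_) (prodDiff-expansion ks (i ℕ.+ s))) ⟩
      Σ (suc j) (λ s → sign s * B j s * Σ (suc c) (λ u → sign u * E u * (+ (i ℕ.+ s)) ^ u))
        ≡⟨ Σ-swap-scaled (suc j) (suc c) (λ s → sign s * B j s) (λ u → sign u * E u) (λ s u → (+ (i ℕ.+ s)) ^ u) ⟩
      Σ (suc c) (λ u → sign u * E u * Σ (suc j) (λ s → sign s * B j s * (+ (i ℕ.+ s)) ^ u))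
        ≡⟨ Σ-ext (suc c) (λ u → cong (sign u * E u *_) (finiteDifference-power j i u)) ⟩
      Σ (suc c) (λ u → sign u * E u * (sign j * σ u)) ∎
      where open ≡-Reasoning

    ΔY≡N₁ : + suc j' * (sign j' * Σ c (λ w → B c' w * (+ suc m) ^ (c' ∸ w) * (sign w * σ′ w))) ≡ sign (c ℕ.+ j) * N₁
    ΔY≡N₁ = begin
      + suc j' * (sign j' * Σ c t)
        ≡⟨ cong (+ suc j' *_) (sym (Σ-*ˡ c (sign j') t)) ⟩
      + suc j' * Σ c (λ w → sign j' * t w)
        ≡⟨ sym (Σ-*ˡ c (+ suc j') (λ w → sign j' * t w)) ⟩
      Σ c (λ w → + suc j' * (sign j' * t w))
        ≡⟨ Σ-cong c resign ⟩
      Σ c (λ w → sign (c ℕ.+ j) * (sign (c' ∸ w) * t′ w))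
        ≡⟨ Σ-*ˡ c (sign (c ℕ.+ j)) (λ w → sign (c' ∸ w) * t′ w) ⟩
      sign (c ℕ.+ j) * N₁ ∎
      where
      open ≡-Reasoning
      t t′ : ℕ → ℤ
      t  w = B c' w * (+ suc m) ^ (c' ∸ w) * (sign w * σ′ w)
      t′ w = + suc j' * B c' w * (+ suc m) ^ (c' ∸ w) * σ′ w
      -- (-1)^(c+j) = (-1)^(c'+j'), and (-1)^(c'+j') (-1)^(c'-w) = (-1)^(j'+w).
      sign-shift : ∀ w → w ℕ.≤ c' → sign (c ℕ.+ j) * sign (c' ∸ w) ≡ sign j' * sign w
      sign-shift w w≤c' = trans (cong (λ z → sign z * sign (c' ∸ w)) (ℕP.+-suc c j'))
                                (trans (cong (_* sign (c' ∸ w)) (neg-involutive (sign (c' ℕ.+ j')))) (sign-reflect c' j' w w≤c'))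
      resign : ∀ w → w ℕ.< c → + suc j' * (sign j' * t w) ≡ sign (c ℕ.+ j) * (sign (c' ∸ w) * t′ w)
      resign w (s≤s w≤c') = begin
        + suc j' * (sign j' * t w)
          ≡⟨ regroup (+ suc j') (sign j') (B c' w) ((+ suc m) ^ (c' ∸ w)) (sign w) (σ′ w) ⟩
        sign j' * sign w * t′ w
          ≡⟨ cong (_* t′ w) (sym (sign-shift w w≤c')) ⟩
        sign (c ℕ.+ j) * sign (c' ∸ w) * t′ w
          ≡⟨ *-assoc (sign (c ℕ.+ j)) (sign (c' ∸ w)) (t′ w) ⟩
        sign (c ℕ.+ j) * (sign (c' ∸ w) * t′ w) ∎
        where
        regroup : ∀ a g b p s n → a * (g * (b * p * (s * n))) ≡ g * s * (a * b * p * n)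
        regroup = solve-∀

    ΔP≡N₂ : Σ (suc c) (λ u → sign u * E u * (sign j * σ u)) ≡ sign (c ℕ.+ j) * N₂
    ΔP≡N₂ = trans (Σ-cong (suc c) resign) (Σ-*ˡ (suc c) (sign (c ℕ.+ j)) (λ u → sign (c ∸ u) * (E u * σ u)))
      where
      resign : ∀ u → u ℕ.< suc c → sign u * E u * (sign j * σ u) ≡ sign (c ℕ.+ j) * (sign (c ∸ u) * (E u * σ u))
      resign u (s≤s u≤c) = trans (regroup (sign u) (E u) (sign j) (σ u))
                                 (trans (cong (_* (E u * σ u)) (sym (sign-reflect c j u u≤c)))
                                        (*-assoc (sign (c ℕ.+ j)) (sign (c ∸ u)) (E u * σ u)))
        where
        regroup : ∀ s e g n → s * e * (g * n) ≡ g * s * (e * n)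
        regroup = solve-∀

    finiteDifferenceIsNumQ : Δh m ks i j ≡ sign (c ℕ.+ j) * numQ m ks i j
    finiteDifferenceIsNumQ = begin
      Δh m ks i j
        ≡⟨ Δh-split ⟩
      ΔY - ΔP
        ≡⟨ cong₂ _-_ (trans ΔY-absorb (cong (+ suc j' *_) ΔY-Stirling)) ΔP-Stirling ⟩
      + suc j' * (sign j' * Σ c (λ w → B c' w * (+ suc m) ^ (c' ∸ w) * (sign w * σ′ w)))
        - Σ (suc c) (λ u → sign u * E u * (sign j * σ u))
        ≡⟨ cong₂ _-_ ΔY≡N₁ ΔP≡N₂ ⟩
      sign (c ℕ.+ j) * N₁ - sign (c ℕ.+ j) * N₂
        ≡⟨ factor (sign (c ℕ.+ j)) N₁ N₂ ⟩
      sign (c ℕ.+ j) * (N₁ - N₂)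
        ≡⟨ cong (sign (c ℕ.+ j) *_) (sym numQ-split) ⟩
      sign (c ℕ.+ j) * numQ m ks i j ∎
      where
      open ≡-Reasoning
      factor : ∀ a x y → a * x - a * y ≡ a * (x - y)
      factor = solve-∀

  φ : ℕ → ∀ {c'} → Vec ℕ (suc c') → ℕ → ℕ → ℤ
  φ m {c'} ks r x = + suc r * (+ m - + r) ^ c' * B x (suc r) - prodDiff ks r * B x r

  φ≡ : ∀ m {c'} (ks : Vec ℕ (suc c')) r x → φ m ks r x ≡ B x r * h m ks r x
  φ≡ m {c'} ks r x = begin
    + suc r * Y * B x (suc r) - prodDiff ks r * B x r    ≡⟨ cong (_- prodDiff ks r * B x r) (regroup (+ suc r) Y (B x (suc r))) ⟩
    Y * (+ suc r * B x (suc r)) - prodDiff ks r * B x r  ≡⟨ cong (λ z → Y * z - prodDiff ks r * B x r) (absorb-lower x r) ⟩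
    Y * ((+ x - + r) * B x r) - prodDiff ks r * B x r    ≡⟨ factor Y (+ x - + r) (B x r) (prodDiff ks r) ⟩
    B x r * h m ks r x                                   ∎
    where
    open ≡-Reasoning
    Y = (+ m - + r) ^ c'
    regroup : ∀ a y b → a * y * b ≡ y * (a * b)
    regroup = solve-∀
    factor : ∀ y d b p → y * (d * b) - p * b ≡ b * (d * y - p)
    factor = solve-∀

  -- Binomial inversion, pointwise: the combination Σ_r (-1)^(r-i) C(r, i) φ_r(x)
  -- is, up to the sign (-1)^c, the integrand of the recurrence for P[X∩ = i].

  module Inversion (m c' : ℕ) (ks : Vec ℕ (suc c')) (i : ℕ) where
    c = suc c'

    weighted : ℕ → ℕ → ℤ
    weighted r x = sign (r ∸ i) * B r i * φ m ks r x

    combination : ℕ → ℤ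
    combination x = Σ (suc m) (λ r → weighted r x)

    weighted-< : ∀ r x → r ℕ.< i → weighted r x ≡ 0ℤ
    weighted-< r x r<i = trans (cong (λ w → sign (r ∸ i) * + w * φ m ks r x) (bin-vanish r i r<i))
                               (vanish (sign (r ∸ i)) (φ m ks r x))
      where
      vanish : ∀ a b → a * + 0 * b ≡ 0ℤ
      vanish = solve-∀

    -- Below i every term has C(r, i) = 0 or C(x, r) = 0.
    combination-below : ∀ x → x ℕ.< i → combination x ≡ 0ℤ
    combination-below x x<i = Σ-zero (suc m) vanish
      where
      vanish : ∀ r → r ℕ.< suc m → weighted r x ≡ 0ℤ
      vanish r _ with r ℕ.<? i
      ... | yes r<i = weighted-< r x r<i
      ... | no r≮i  = trans (cong (sign (r ∸ i) * B r i *_)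
                              (trans (φ≡ m ks r x) (trans (cong (λ w → + w * h m ks r x) (bin-vanish x r (ℕP.<-≤-trans x<i (ℕP.≮⇒≥ r≮i))))
                                                          (*-zeroˡ (h m ks r x)))))
                            (*-zeroʳ (sign (r ∸ i) * B r i))

    -- C(i+s, i) C(i+j, i+s) = C(i+j, i) C(j, s) moves the weight onto h.
    weighted-revision : ∀ j s → weighted (i ℕ.+ s) (i ℕ.+ j) ≡ B (i ℕ.+ j) i * (sign s * B j s * h m ks (i ℕ.+ s) (i ℕ.+ j))
    weighted-revision j s = begin
      sign ((i ℕ.+ s) ∸ i) * B (i ℕ.+ s) i * φ m ks (i ℕ.+ s) x
        ≡⟨ cong₂ (λ a b → sign a * B (i ℕ.+ s) i * b) (ℕP.m+n∸m≡n i s) (φ≡ m ks (i ℕ.+ s) x) ⟩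
      sign s * B (i ℕ.+ s) i * (B x (i ℕ.+ s) * h m ks (i ℕ.+ s) x)
        ≡⟨ regroup₁ (sign s) (B (i ℕ.+ s) i) (B x (i ℕ.+ s)) (h m ks (i ℕ.+ s) x) ⟩
      sign s * (B (i ℕ.+ s) i * B x (i ℕ.+ s)) * h m ks (i ℕ.+ s) x
        ≡⟨ cong (λ z → sign s * z * h m ks (i ℕ.+ s) x) revision ⟩
      sign s * (B x i * B j s) * h m ks (i ℕ.+ s) x
        ≡⟨ regroup₂ (sign s) (B x i) (B j s) (h m ks (i ℕ.+ s) x) ⟩
      B x i * (sign s * B j s * h m ks (i ℕ.+ s) x) ∎
      where
      open ≡-Reasoning
      x = i ℕ.+ j
      revision : B (i ℕ.+ s) i * B x (i ℕ.+ s) ≡ B x i * B j s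
      revision = begin
        B (i ℕ.+ s) i * B x (i ℕ.+ s)            ≡⟨ sym (pos-* (bin (i ℕ.+ s) i) (bin x (i ℕ.+ s))) ⟩
        + (bin (i ℕ.+ s) i ℕ.* bin x (i ℕ.+ s))  ≡⟨ cong +_ (bin-revision i s x (ℕP.m≤m+n i j)) ⟩
        + (bin x i ℕ.* bin (x ∸ i) s)            ≡⟨ cong (λ z → + (bin x i ℕ.* bin z s)) (ℕP.m+n∸m≡n i j) ⟩
        + (bin x i ℕ.* bin j s)                  ≡⟨ pos-* (bin x i) (bin j s) ⟩
        B x i * B j s                            ∎
      regroup₁ : ∀ g a b h → g * a * (b * h) ≡ g * (a * b) * h
      regroup₁ = solve-∀
      regroup₂ : ∀ g a b h → g * (a * b) * h ≡ a * (g * b * h)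
      regroup₂ = solve-∀

    combination-above : ∀ j → i ℕ.+ j ℕ.≤ m → combination (i ℕ.+ j) ≡ B (i ℕ.+ j) i * Δh m ks i j
    combination-above j i+j≤m = begin
      combination x
        ≡⟨ cong (λ z → Σ z (λ r → weighted r x)) (sym length-split) ⟩
      Σ (i ℕ.+ (suc j ℕ.+ (m ∸ x))) (λ r → weighted r x)
        ≡⟨ Σ-dropZeroPrefix i (suc j ℕ.+ (m ∸ x)) (λ r → weighted r x) (λ r → weighted-< r x) ⟩
      Σ (suc j ℕ.+ (m ∸ x)) (λ s → weighted (i ℕ.+ s) x)
        ≡⟨ Σ-ext (suc j ℕ.+ (m ∸ x)) (weighted-revision j) ⟩
      Σ (suc j ℕ.+ (m ∸ x)) (λ s → B x i * δh s)
        ≡⟨ Σ-*ˡ (suc j ℕ.+ (m ∸ x)) (B x i) δh ⟩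
      B x i * Σ (suc j ℕ.+ (m ∸ x)) δh
        ≡⟨ cong (B x i *_) (Σ-dropZeroSuffix (suc j) (m ∸ x) δh beyond-j) ⟩
      B x i * Δh m ks i j ∎
      where
      open ≡-Reasoning
      x = i ℕ.+ j
      δh : ℕ → ℤ
      δh s = sign s * B j s * h m ks (i ℕ.+ s) x
      length-split : i ℕ.+ (suc j ℕ.+ (m ∸ x)) ≡ suc m
      length-split = trans (sym (ℕP.+-assoc i (suc j) (m ∸ x)))
                           (trans (cong (ℕ._+ (m ∸ x)) (ℕP.+-suc i j)) (cong suc (ℕP.m+[n∸m]≡n i+j≤m)))
      beyond-j : ∀ s → suc j ℕ.≤ s → δh s ≡ 0ℤ
      beyond-j s j<s = trans (cong (λ w → sign s * + w * h m ks (i ℕ.+ s) x) (bin-vanish j s j<s))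
                             (vanish (sign s) (h m ks (i ℕ.+ s) x))
        where
        vanish : ∀ a b → a * + 0 * b ≡ 0ℤ
        vanish = solve-∀

    D : ℤ
    D = denomQ ks i

    coeff : ℕ → ℤ
    coeff j = sign j * + ((i ℕ.+ j) C j) * numQ m ks i j

    integrand : ℕ → ℤ
    integrand x = - D * δ i x + sumℤ (map (λ j → coeff j * δ (i ℕ.+ j) x) (range 1 c'))

    integrand-tail : ∀ x → sumℤ (map (λ j → coeff j * δ (i ℕ.+ j) x) (range 1 c')) ≡ Σ c' (λ s → coeff (suc s) * δ (i ℕ.+ suc s) x)
    integrand-tail x = sumℤ-range 1 c' (λ j → coeff j * δ (i ℕ.+ j) x)

    integrand-below : ∀ x → x ℕ.< i → integrand x ≡ 0ℤ
    integrand-below x x<i = trans (cong₂ _+_ at-i beyond-i) (+-identityʳ 0ℤ)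
      where
      x≢i+ : ∀ t → x ≢ i ℕ.+ t
      x≢i+ t x≡ = ℕP.<⇒≱ x<i (subst (i ℕ.≤_) (sym x≡) (ℕP.m≤m+n i t))
      at-i : - D * δ i x ≡ 0ℤ
      at-i = trans (cong (- D *_) (δ-diff i x (λ x≡i → x≢i+ 0 (trans x≡i (sym (ℕP.+-identityʳ i)))))) (*-zeroʳ (- D))
      beyond-i : sumℤ (map (λ j → coeff j * δ (i ℕ.+ j) x) (range 1 c')) ≡ 0ℤ
      beyond-i = trans (integrand-tail x) (Σ-zero c' (λ s _ →
        trans (cong (coeff (suc s) *_) (δ-diff (i ℕ.+ suc s) x (x≢i+ (suc s)))) (*-zeroʳ (coeff (suc s)))))

    integrand-at : integrand i ≡ - D
    integrand-at = trans (cong₂ _+_ (trans (cong (- D *_) (δ-same i)) (*-identityʳ (- D))) beyond-i) (+-identityʳ (- D))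
      where
      beyond-i : sumℤ (map (λ j → coeff j * δ (i ℕ.+ j) i) (range 1 c')) ≡ 0ℤ
      beyond-i = trans (integrand-tail i) (Σ-zero c' (λ s _ →
        trans (cong (coeff (suc s) *_) (δ-diff (i ℕ.+ suc s) i (λ i≡ → ℕP.m≢1+m+n i (trans i≡ (ℕP.+-suc i s)))))
              (*-zeroʳ (coeff (suc s)))))

    -- Beyond c-1 the coefficient vanishes with numQ, so no term is missing.
    integrand-above : ∀ j' → integrand (i ℕ.+ suc j') ≡ coeff (suc j')
    integrand-above j' = begin
      - D * δ i x + sumℤ (map (λ j → coeff j * δ (i ℕ.+ j) x) (range 1 c'))
        ≡⟨ cong₂ _+_ (trans (cong (- D *_) (δ-diff i x (λ x≡i → ℕP.m≢1+m+n i (trans (sym x≡i) (ℕP.+-suc i j'))))) (*-zeroʳ (- D)))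
                     (integrand-tail x) ⟩
      0ℤ + Σ c' (λ s → coeff (suc s) * δ (i ℕ.+ suc s) x)
        ≡⟨ +-identityˡ _ ⟩
      Σ c' (λ s → coeff (suc s) * δ (i ℕ.+ suc s) x)
        ≡⟨ Σ-ext c' (λ s → cong (coeff (suc s) *_) (trans (δ-shift i (suc s) (suc j')) (δ-shift 1 s j'))) ⟩
      Σ c' (λ s → coeff (suc s) * δ s j')
        ≡⟨ pick ⟩
      coeff (suc j') ∎
      where
      open ≡-Reasoning
      x = i ℕ.+ suc j'
      pick : Σ c' (λ s → coeff (suc s) * δ s j') ≡ coeff (suc j')
      pick with j' ℕ.<? c'
      ... | yes j'<c' = Σδ-inside c' j' (λ s → coeff (suc s)) j'<c'
      ... | no j'≮c'  = trans (Σδ-outside c' j' (λ s → coeff (suc s)) (ℕP.≮⇒≥ j'≮c'))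
                              (sym (trans (cong (sign (suc j') * + ((i ℕ.+ suc j') C suc j') *_)
                                                (NumeratorQ.numQ-vanish m c' ks i j' (ℕP.≮⇒≥ j'≮c')))
                                          (*-zeroʳ (sign (suc j') * + ((i ℕ.+ suc j') C suc j')))))

    inversion : ∀ x → x ℕ.≤ m → sign c * combination x ≡ integrand x
    inversion x x≤m with x ℕ.<? i
    ... | yes x<i = trans (cong (sign c *_) (combination-below x x<i))
                          (trans (*-zeroʳ (sign c)) (sym (integrand-below x x<i)))
    ... | no x≮i with x ∸ i | ℕP.m+[n∸m]≡n (ℕP.≮⇒≥ x≮i)
    ...   | d | i+d≡x = subst (λ y → sign c * combination y ≡ integrand y) i+d≡x
                              (at d (subst (ℕ._≤ m) (sym i+d≡x) x≤m))
      where
      at : ∀ j → i ℕ.+ j ℕ.≤ m → sign c * combination (i ℕ.+ j) ≡ integrand (i ℕ.+ j)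
      at zero i≤m = begin
        sign c * combination (i ℕ.+ 0)          ≡⟨ cong (sign c *_) (combination-above 0 i≤m) ⟩
        sign c * (B (i ℕ.+ 0) i * Δh m ks i 0)  ≡⟨ cong (λ z → sign c * (+ bin z i * Δh m ks i 0)) (ℕP.+-identityʳ i) ⟩
        sign c * (B i i * Δh m ks i 0)          ≡⟨ cong (λ z → sign c * (+ z * Δh m ks i 0)) (bin-nn i) ⟩
        sign c * (+ 1 * Δh m ks i 0)            ≡⟨ cong (λ z → sign c * (+ 1 * z)) Δh-0 ⟩
        sign c * (+ 1 * - prodDiff ks i)        ≡⟨ regroup (sign c) (prodDiff ks i) ⟩
        - (sign c * prodDiff ks i)              ≡⟨ cong -_ (sym (denomQ≡ ks i)) ⟩
        - D                                     ≡⟨ sym integrand-at ⟩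
        integrand i                             ≡⟨ cong integrand (sym (ℕP.+-identityʳ i)) ⟩
        integrand (i ℕ.+ 0)                     ∎
        where
        open ≡-Reasoning
        Δh-0 : Δh m ks i 0 ≡ - prodDiff ks i
        Δh-0 = trans (+-identityʳ _) (trans (*-identityˡ _)
                 (trans (cong (λ z → (+ z - + z) * (+ m - + z) ^ c' - prodDiff ks z) (ℕP.+-identityʳ i))
                        (vanish (+ i) ((+ m - + i) ^ c') (prodDiff ks i))))
          where
          vanish : ∀ a y p → (a - a) * y - p ≡ - p
          vanish = solve-∀
        regroup : ∀ s p → s * (+ 1 * - p) ≡ - (s * p)
        regroup = solve-∀
      at (suc j') i+j≤m = begin
        sign c * combination (i ℕ.+ j)                ≡⟨ cong (sign c *_) (combination-above j i+j≤m) ⟩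
        sign c * (B (i ℕ.+ j) i * Δh m ks i j)        ≡⟨ cong (λ z → sign c * (B (i ℕ.+ j) i * z)) (DifferenceOfH.finiteDifferenceIsNumQ m c' ks i j') ⟩
        sign c * (B (i ℕ.+ j) i * (sign (c ℕ.+ j) * numQ m ks i j))
          ≡⟨ regroup (sign c) (B (i ℕ.+ j) i) (sign (c ℕ.+ j)) (numQ m ks i j) ⟩
        sign c * sign (c ℕ.+ j) * B (i ℕ.+ j) i * numQ m ks i j
          ≡⟨ cong₂ (λ a b → a * + b * numQ m ks i j) (sign-cancel c j) (trans (bin-symmetric i j) (bin≡C (i ℕ.+ j) j)) ⟩
        coeff j                                       ≡⟨ sym (integrand-above j') ⟩
        integrand (i ℕ.+ j)                           ∎
        where
        open ≡-Reasoning
        j = suc j'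
        regroup : ∀ s b t n → s * (b * (t * n)) ≡ s * t * b * n
        regroup = solve-∀

  filter-map : ∀ {A B : Set} {P : Pred B 0ℓ} (P? : Decidable P) (g : A → B) (L : List A) →
               filter P? (map g L) ≡ map g (filter (λ x → P? (g x)) L)
  filter-map P? g []      = refl
  filter-map P? g (x ∷ L) with does (P? (g x))
  ... | true  = cong (g x ∷_) (filter-map P? g L)
  ... | false = filter-map P? g L

  subsetsOfSize-suc-zero : ∀ m → subsetsOfSize (suc m) 0 ≡ map (outside ∷_) (subsetsOfSize m 0)
  subsetsOfSize-suc-zero m = begin
    filter (λ A → (∣ A ∣) ℕ.≟ 0) (map (inside ∷_) L ++ map (outside ∷_) L)
      ≡⟨ ListP.filter-++ (λ A → (∣ A ∣) ℕ.≟ 0) (map (inside ∷_) L) (map (outside ∷_) L) ⟩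
    filter (λ A → (∣ A ∣) ℕ.≟ 0) (map (inside ∷_) L) ++ filter (λ A → (∣ A ∣) ℕ.≟ 0) (map (outside ∷_) L)
      ≡⟨ cong₂ _++_ (trans (filter-map (λ A → (∣ A ∣) ℕ.≟ 0) (inside ∷_) L)
                           (cong (map (inside ∷_)) (ListP.filter-none (λ A → (∣ inside ∷ A ∣) ℕ.≟ 0) {L} (ListAll.tabulate (λ _ ())))))
                    (filter-map (λ A → (∣ A ∣) ℕ.≟ 0) (outside ∷_) L) ⟩
    map (outside ∷_) (subsetsOfSize m 0) ∎
    where
    open ≡-Reasoning
    L = allSubsets m

  subsetsOfSize-suc-suc : ∀ m k → subsetsOfSize (suc m) (suc k)
                                ≡ map (inside ∷_) (subsetsOfSize m k) ++ map (outside ∷_) (subsetsOfSize m (suc k))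
  subsetsOfSize-suc-suc m k = begin
    filter P? (map (inside ∷_) L ++ map (outside ∷_) L)
      ≡⟨ ListP.filter-++ P? (map (inside ∷_) L) (map (outside ∷_) L) ⟩
    filter P? (map (inside ∷_) L) ++ filter P? (map (outside ∷_) L)
      ≡⟨ cong₂ _++_ (trans (filter-map P? (inside ∷_) L)
                           (cong (map (inside ∷_)) (ListP.filter-≐ (λ A → (∣ inside ∷ A ∣) ℕ.≟ suc k) (λ A → (∣ A ∣) ℕ.≟ k)
                                                                    (ℕP.suc-injective , cong suc) L)))
                    (filter-map P? (outside ∷_) L) ⟩
    map (inside ∷_) (subsetsOfSize m k) ++ map (outside ∷_) (subsetsOfSize m (suc k)) ∎
    where
    open ≡-Reasoning
    L = allSubsets m
    P? = λ (A : Subset (suc m)) → (∣ A ∣) ℕ.≟ suc k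

  ΣLℕ-subsetsOfSize-suc : ∀ m k (f : Subset (suc m) → ℕ) → ΣLℕ (subsetsOfSize (suc m) (suc k)) f
    ≡ ΣLℕ (subsetsOfSize m k) (λ A → f (inside ∷ A)) ℕ.+ ΣLℕ (subsetsOfSize m (suc k)) (λ A → f (outside ∷ A))
  ΣLℕ-subsetsOfSize-suc m k f = begin
    ΣLℕ (subsetsOfSize (suc m) (suc k)) f
      ≡⟨ cong (λ L → ΣLℕ L f) (subsetsOfSize-suc-suc m k) ⟩
    ΣLℕ (map (inside ∷_) (subsetsOfSize m k) ++ map (outside ∷_) (subsetsOfSize m (suc k))) f
      ≡⟨ ΣLℕ-++ (map (inside ∷_) (subsetsOfSize m k)) (map (outside ∷_) (subsetsOfSize m (suc k))) f ⟩
    ΣLℕ (map (inside ∷_) (subsetsOfSize m k)) f ℕ.+ ΣLℕ (map (outside ∷_) (subsetsOfSize m (suc k))) f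
      ≡⟨ cong₂ ℕ._+_ (ΣLℕ-map (inside ∷_) (subsetsOfSize m k) f) (ΣLℕ-map (outside ∷_) (subsetsOfSize m (suc k)) f) ⟩
    ΣLℕ (subsetsOfSize m k) (λ A → f (inside ∷ A)) ℕ.+ ΣLℕ (subsetsOfSize m (suc k)) (λ A → f (outside ∷ A)) ∎
    where open ≡-Reasoning

  -- containing m k r = C(m-r, k-r), the number of k-subsets of [m] that
  -- contain a fixed r-set (defined by the matching recursion).
  containing : ℕ → ℕ → ℕ → ℕ
  containing m       k       zero    = bin m k
  containing m       zero    (suc r) = 0
  containing zero    (suc k) (suc r) = containing zero k r
  containing (suc m) (suc k) (suc r) = containing m k r

  containing-pascal : ∀ m k r → r ℕ.≤ m → containing m k r ℕ.+ containing m (suc k) r ≡ containing (suc m) (suc k) r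
  containing-pascal m       k       zero    _         = refl
  containing-pascal (suc m) zero    (suc r) (s≤s r≤m) = containing-empty m r
    where
    containing-empty : ∀ m r → containing m 0 r ≡ containing (suc m) 0 r
    containing-empty m zero    = bin-n0 m
    containing-empty m (suc r) = refl
  containing-pascal (suc m) (suc k) (suc r) (s≤s r≤m) = containing-pascal m k r r≤m

  -- When r > m the factor C(s, r) (s ≤ m) vanishes, so Pascal's rule may be used freely.
  containing-pascal′ : ∀ s m k r → s ℕ.≤ m →
    bin s r ℕ.* (containing m k r ℕ.+ containing m (suc k) r) ≡ bin s r ℕ.* containing (suc m) (suc k) r
  containing-pascal′ s m k r s≤m with r ℕ.≤? m
  ... | yes r≤m = cong (bin s r ℕ.*_) (containing-pascal m k r r≤m)
  ... | no r≰m  = trans (cong (ℕ._* _) bin-0) (sym (cong (ℕ._* _) bin-0))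
    where
    bin-0 : bin s r ≡ 0
    bin-0 = bin-vanish s r (ℕP.≤-<-trans s≤m (ℕP.≰⇒> r≰m))

  -- Σ_{|A| = k} C(|S ∩ A|, r) = C(|S|, r) · C(m-r, k-r): both count pairs
  -- (R, A) with R an r-subset of S and R ⊆ A.
  Σsubsets-bin : ∀ m k (S : Subset m) r →
    ΣLℕ (subsetsOfSize m k) (λ A → bin (∣ S ∩ A ∣) r) ≡ bin (∣ S ∣) r ℕ.* containing m k r
  Σsubsets-bin zero zero    [] zero    = refl
  Σsubsets-bin zero zero    [] (suc r) = refl
  Σsubsets-bin zero (suc k) [] zero    = refl
  Σsubsets-bin zero (suc k) [] (suc r) = refl
  Σsubsets-bin (suc m) zero (x ∷ S) r = begin
    ΣLℕ (subsetsOfSize (suc m) 0) (λ A → bin (∣ (x ∷ S) ∩ A ∣) r)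
      ≡⟨ cong (λ L → ΣLℕ L (λ A → bin (∣ (x ∷ S) ∩ A ∣) r)) (subsetsOfSize-suc-zero m) ⟩
    ΣLℕ (map (outside ∷_) (subsetsOfSize m 0)) (λ A → bin (∣ (x ∷ S) ∩ A ∣) r)
      ≡⟨ ΣLℕ-map (outside ∷_) (subsetsOfSize m 0) (λ A → bin (∣ (x ∷ S) ∩ A ∣) r) ⟩
    ΣLℕ (subsetsOfSize m 0) (λ A → bin (∣ (x ∷ S) ∩ (outside ∷ A) ∣) r)
      ≡⟨ ΣLℕ-ext (subsetsOfSize m 0) (λ A → cong (λ z → bin z r) (drop x A)) ⟩
    ΣLℕ (subsetsOfSize m 0) (λ A → bin (∣ S ∩ A ∣) r)
      ≡⟨ Σsubsets-bin m 0 S r ⟩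
    bin (∣ S ∣) r ℕ.* containing m 0 r
      ≡⟨ empty-A r ⟩
    bin (∣ x ∷ S ∣) r ℕ.* containing (suc m) 0 r ∎
    where
    open ≡-Reasoning
    drop : ∀ x A → (∣ (x ∷ S) ∩ (outside ∷ A) ∣) ≡ (∣ S ∩ A ∣)
    drop true  A = refl
    drop false A = refl
    empty-A : ∀ r → bin (∣ S ∣) r ℕ.* containing m 0 r ≡ bin (∣ x ∷ S ∣) r ℕ.* containing (suc m) 0 r
    empty-A zero    = trans (cong₂ ℕ._*_ (bin-n0 ∣ S ∣) (bin-n0 m)) (sym (cong (ℕ._* 1) (bin-n0 ∣ x ∷ S ∣)))
    empty-A (suc r) = trans (ℕP.*-zeroʳ (bin (∣ S ∣) (suc r))) (sym (ℕP.*-zeroʳ (bin (∣ x ∷ S ∣) (suc r))))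
  Σsubsets-bin (suc m) (suc k) (outside ∷ S) r = begin
    ΣLℕ (subsetsOfSize (suc m) (suc k)) (λ A → bin (∣ (outside ∷ S) ∩ A ∣) r)
      ≡⟨ ΣLℕ-subsetsOfSize-suc m k (λ A → bin (∣ (outside ∷ S) ∩ A ∣) r) ⟩
    ΣLℕ (subsetsOfSize m k) (λ A → bin (∣ S ∩ A ∣) r) ℕ.+ ΣLℕ (subsetsOfSize m (suc k)) (λ A → bin (∣ S ∩ A ∣) r)
      ≡⟨ cong₂ ℕ._+_ (Σsubsets-bin m k S r) (Σsubsets-bin m (suc k) S r) ⟩
    bin (∣ S ∣) r ℕ.* containing m k r ℕ.+ bin (∣ S ∣) r ℕ.* containing m (suc k) r
      ≡⟨ sym (ℕP.*-distribˡ-+ (bin (∣ S ∣) r) _ _) ⟩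
    bin (∣ S ∣) r ℕ.* (containing m k r ℕ.+ containing m (suc k) r)
      ≡⟨ containing-pascal′ (∣ S ∣) m k r (∣p∣≤n S) ⟩
    bin (∣ S ∣) r ℕ.* containing (suc m) (suc k) r ∎
    where open ≡-Reasoning
  Σsubsets-bin (suc m) (suc k) (inside ∷ S) zero = begin
    ΣLℕ (subsetsOfSize (suc m) (suc k)) (λ A → bin (∣ (inside ∷ S) ∩ A ∣) 0)
      ≡⟨ ΣLℕ-subsetsOfSize-suc m k (λ A → bin (∣ (inside ∷ S) ∩ A ∣) 0) ⟩
    ΣLℕ (subsetsOfSize m k) (λ A → 1) ℕ.+ ΣLℕ (subsetsOfSize m (suc k)) (λ A → bin (∣ S ∩ A ∣) 0)
      ≡⟨ cong (ℕ._+ ΣLℕ (subsetsOfSize m (suc k)) (λ A → bin (∣ S ∩ A ∣) 0))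
              (ΣLℕ-ext (subsetsOfSize m k) (λ A → sym (bin-n0 (∣ S ∩ A ∣)))) ⟩
    ΣLℕ (subsetsOfSize m k) (λ A → bin (∣ S ∩ A ∣) 0) ℕ.+ ΣLℕ (subsetsOfSize m (suc k)) (λ A → bin (∣ S ∩ A ∣) 0)
      ≡⟨ cong₂ ℕ._+_ (Σsubsets-bin m k S 0) (Σsubsets-bin m (suc k) S 0) ⟩
    bin (∣ S ∣) 0 ℕ.* bin m k ℕ.+ bin (∣ S ∣) 0 ℕ.* bin m (suc k)
      ≡⟨ sym (ℕP.*-distribˡ-+ (bin (∣ S ∣) 0) (bin m k) (bin m (suc k))) ⟩
    bin (∣ S ∣) 0 ℕ.* bin (suc m) (suc k)
      ≡⟨ cong (ℕ._* bin (suc m) (suc k)) (bin-n0 (∣ S ∣)) ⟩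
    1 ℕ.* bin (suc m) (suc k) ∎
    where open ≡-Reasoning
  Σsubsets-bin (suc m) (suc k) (inside ∷ S) (suc r) = begin
    ΣLℕ (subsetsOfSize (suc m) (suc k)) (λ A → bin (∣ (inside ∷ S) ∩ A ∣) (suc r))
      ≡⟨ ΣLℕ-subsetsOfSize-suc m k (λ A → bin (∣ (inside ∷ S) ∩ A ∣) (suc r)) ⟩
    ΣLℕ (subsetsOfSize m k) (λ A → bin (∣ S ∩ A ∣) r ℕ.+ bin (∣ S ∩ A ∣) (suc r))
      ℕ.+ ΣLℕ (subsetsOfSize m (suc k)) (λ A → bin (∣ S ∩ A ∣) (suc r))
      ≡⟨ cong (ℕ._+ ΣLℕ (subsetsOfSize m (suc k)) (λ A → bin (∣ S ∩ A ∣) (suc r)))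
              (ΣLℕ-+ (subsetsOfSize m k) (λ A → bin (∣ S ∩ A ∣) r) (λ A → bin (∣ S ∩ A ∣) (suc r))) ⟩
    ΣLℕ (subsetsOfSize m k) (λ A → bin (∣ S ∩ A ∣) r) ℕ.+ ΣLℕ (subsetsOfSize m k) (λ A → bin (∣ S ∩ A ∣) (suc r))
      ℕ.+ ΣLℕ (subsetsOfSize m (suc k)) (λ A → bin (∣ S ∩ A ∣) (suc r))
      ≡⟨ cong₂ ℕ._+_ (cong₂ ℕ._+_ (Σsubsets-bin m k S r) (Σsubsets-bin m k S (suc r))) (Σsubsets-bin m (suc k) S (suc r)) ⟩
    bin s r ℕ.* containing m k r ℕ.+ bin s (suc r) ℕ.* containing m k (suc r) ℕ.+ bin s (suc r) ℕ.* containing m (suc k) (suc r)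
      ≡⟨ regroup (bin s r) (containing m k r) (bin s (suc r)) (containing m k (suc r)) (containing m (suc k) (suc r)) ⟩
    bin s r ℕ.* containing m k r ℕ.+ bin s (suc r) ℕ.* (containing m k (suc r) ℕ.+ containing m (suc k) (suc r))
      ≡⟨ cong (bin s r ℕ.* containing m k r ℕ.+_) (containing-pascal′ s m k (suc r) (∣p∣≤n S)) ⟩
    bin s r ℕ.* containing m k r ℕ.+ bin s (suc r) ℕ.* containing m k r
      ≡⟨ sym (ℕP.*-distribʳ-+ (containing m k r) (bin s r) (bin s (suc r))) ⟩
    bin (suc s) (suc r) ℕ.* containing (suc m) (suc k) (suc r) ∎
    where
    open ≡-Reasoning
    s = (∣ S ∣)
    regroup : ∀ a b c d e → a ℕ.* b ℕ.+ c ℕ.* d ℕ.+ c ℕ.* e ≡ a ℕ.* b ℕ.+ c ℕ.* (d ℕ.+ e)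
    regroup = ℕSolver.solve-∀

  ⋂ : ∀ {m c} → Vec (Subset m) c → Subset m
  ⋂ {m} As = Vec.foldr (λ _ → Subset m) _∩_ ⊤ As

  prodN : ∀ {c} → (ℕ → ℕ) → Vec ℕ c → ℕ
  prodN f []       = 1
  prodN f (k ∷ ks) = f k ℕ.* prodN f ks

  prodN-pos : ∀ m {c} (ks : Vec ℕ c) → All (ℕ._≤ m) ks → 0 ℕ.< prodN (bin m) ks
  prodN-pos m []       []         = s≤s z≤n
  prodN-pos m (k ∷ ks) (k≤m ∷ ok) = ℕP.*-mono-< (bin-pos m k k≤m) (prodN-pos m ks ok)

  containingAll : ℕ → ∀ {c} → Vec ℕ c → ℕ → ℕ
  containingAll m ks r = prodN (λ k → containing m k r) ks

  Σtuples-bin : ∀ m {c} (ks : Vec ℕ c) (S : Subset m) r →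
    ΣLℕ (tuples m ks) (λ As → bin (∣ S ∩ ⋂ As ∣) r) ≡ bin (∣ S ∣) r ℕ.* containingAll m ks r
  Σtuples-bin m []       S r =
    trans (ℕP.+-identityʳ _) (trans (cong (λ z → bin (∣ z ∣) r) (∩-identityʳ S)) (sym (ℕP.*-identityʳ _)))
  Σtuples-bin m (k ∷ ks) S r = begin
    ΣLℕ (concatMap (λ A → map (A ∷_) (tuples m ks)) (subsetsOfSize m k)) f
      ≡⟨ ΣLℕ-concatMap (λ A → map (A ∷_) (tuples m ks)) (subsetsOfSize m k) f ⟩
    ΣLℕ (subsetsOfSize m k) (λ A → ΣLℕ (map (A ∷_) (tuples m ks)) f)
      ≡⟨ ΣLℕ-ext (subsetsOfSize m k) (λ A → ΣLℕ-map (A ∷_) (tuples m ks) f) ⟩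
    ΣLℕ (subsetsOfSize m k) (λ A → ΣLℕ (tuples m ks) (λ As → bin (∣ S ∩ (A ∩ ⋂ As) ∣) r))
      ≡⟨ ΣLℕ-ext (subsetsOfSize m k) inner ⟩
    ΣLℕ (subsetsOfSize m k) (λ A → bin (∣ S ∩ A ∣) r ℕ.* P)
      ≡⟨ ΣLℕ-*ʳ (subsetsOfSize m k) (λ A → bin (∣ S ∩ A ∣) r) P ⟩
    ΣLℕ (subsetsOfSize m k) (λ A → bin (∣ S ∩ A ∣) r) ℕ.* P
      ≡⟨ cong (ℕ._* P) (Σsubsets-bin m k S r) ⟩
    bin (∣ S ∣) r ℕ.* containing m k r ℕ.* P
      ≡⟨ ℕP.*-assoc (bin (∣ S ∣) r) (containing m k r) P ⟩
    bin (∣ S ∣) r ℕ.* (containing m k r ℕ.* P) ∎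
    where
    open ≡-Reasoning
    P = containingAll m ks r
    f : Vec (Subset m) _ → ℕ
    f As = bin (∣ S ∩ ⋂ As ∣) r
    inner : ∀ A → ΣLℕ (tuples m ks) (λ As → bin (∣ S ∩ (A ∩ ⋂ As) ∣) r) ≡ bin (∣ S ∩ A ∣) r ℕ.* P
    inner A = trans (ΣLℕ-ext (tuples m ks) (λ As → cong (λ z → bin (∣ z ∣) r) (sym (∩-assoc S A (⋂ As)))))
                    (Σtuples-bin m ks (S ∩ A) r)

  containing-step : ∀ m k r → k ℕ.≤ m → (+ m - + r) * + containing m k (suc r) ≡ (+ k - + r) * + containing m k r
  containing-step zero    zero    zero    _       = refl
  containing-step (suc m) zero    zero    _       = *-zeroʳ (+ suc m - + 0)
  containing-step (suc m) (suc k) zero    (s≤s _) =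
    trans (cong (_* B m k) (minus-zero (+ suc m)))
          (trans (sym (absorb-upper m k)) (cong (_* B (suc m) (suc k)) (sym (minus-zero (+ suc k)))))
    where
    minus-zero : ∀ x → x - + 0 ≡ x
    minus-zero = solve-∀
  containing-step zero    zero    (suc r) _       = trans (*-zeroʳ (+ 0 - + suc r)) (sym (*-zeroʳ (+ 0 - + suc r)))
  containing-step (suc m) zero    (suc r) _       = trans (*-zeroʳ (+ suc m - + suc r)) (sym (*-zeroʳ (+ 0 - + suc r)))
  containing-step (suc m) (suc k) (suc r) (s≤s k≤m) =
    trans (cong (_* + containing m k (suc r)) (suc-minus-suc m r))
          (trans (containing-step m k r k≤m) (cong (_* + containing m k r) (sym (suc-minus-suc k r))))

  containingAll-step : ∀ m r {c} (ks : Vec ℕ c) → All (ℕ._≤ m) ks →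
    (+ m - + r) ^ c * + containingAll m ks (suc r) ≡ prodDiff ks r * + containingAll m ks r
  containingAll-step m r []               []         = refl
  containingAll-step m r {suc n} (k ∷ ks) (k≤m ∷ ok) = begin
    (+ m - + r) * (+ m - + r) ^ n * + (containing m k (suc r) ℕ.* containingAll m ks (suc r))
      ≡⟨ cong ((+ m - + r) * (+ m - + r) ^ n *_) (pos-* (containing m k (suc r)) (containingAll m ks (suc r))) ⟩
    (+ m - + r) * (+ m - + r) ^ n * (+ containing m k (suc r) * + containingAll m ks (suc r))
      ≡⟨ interchange (+ m - + r) ((+ m - + r) ^ n) (+ containing m k (suc r)) (+ containingAll m ks (suc r)) ⟩
    ((+ m - + r) * + containing m k (suc r)) * ((+ m - + r) ^ n * + containingAll m ks (suc r))
      ≡⟨ cong₂ _*_ (containing-step m k r k≤m) (containingAll-step m r ks ok) ⟩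
    ((+ k - + r) * + containing m k r) * (prodDiff ks r * + containingAll m ks r)
      ≡⟨ interchange (+ k - + r) (+ containing m k r) (prodDiff ks r) (+ containingAll m ks r) ⟩
    (+ k - + r) * prodDiff ks r * (+ containing m k r * + containingAll m ks r)
      ≡⟨ cong ((+ k - + r) * prodDiff ks r *_) (sym (pos-* (containing m k r) (containingAll m ks r))) ⟩
    (+ k - + r) * prodDiff ks r * + (containing m k r ℕ.* containingAll m ks r) ∎
    where
    open ≡-Reasoning
    interchange : ∀ a b x y → a * b * (x * y) ≡ (a * x) * (b * y)
    interchange = solve-∀

  module SampleSpace (m c' : ℕ) (ks : Vec ℕ (suc c')) (ok : All (ℕ._≤ m) ks) where
    c = suc c'

    sample : List (Vec (Subset m) c)
    sample = tuples m ks

    size : ℕ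
    size = length sample

    moment : ℕ → ℕ
    moment s = ΣLℕ sample (λ As → bin (Xcap As) s)

    moment≡ : ∀ s → moment s ≡ bin m s ℕ.* containingAll m ks s
    moment≡ s = trans (ΣLℕ-ext sample (λ As → cong (λ z → bin (∣ z ∣) s) (sym (∩-identityˡ (⋂ As)))))
                      (trans (Σtuples-bin m ks ⊤ s) (cong (λ z → bin z s ℕ.* containingAll m ks s) (∣⊤∣≡n m)))

    size≢0 : size ≢ 0
    size≢0 size≡0 = ℕP.<-irrefl (trans (sym size≡0) size≡) (prodN-pos m ks ok)
      where
      size≡ : size ≡ prodN (bin m) ks
      size≡ = begin
        length sample                                ≡⟨ length≡ΣLℕ sample ⟩
        ΣLℕ sample (λ _ → 1)                         ≡⟨ ΣLℕ-ext sample (λ As → sym (bin-n0 (Xcap As))) ⟩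
        moment 0                                     ≡⟨ moment≡ 0 ⟩
        bin m 0 ℕ.* containingAll m ks 0             ≡⟨ cong (ℕ._* containingAll m ks 0) (bin-n0 m) ⟩
        1 ℕ.* prodN (bin m) ks                       ≡⟨ ℕP.*-identityˡ _ ⟩
        prodN (bin m) ks                             ∎
        where open ≡-Reasoning

    momentRecurrence : ∀ r → + suc r * (+ m - + r) ^ c' * + moment (suc r) ≡ prodDiff ks r * + moment r
    momentRecurrence r = begin
      + suc r * Y * + moment (suc r)
        ≡⟨ cong (λ z → + suc r * Y * z) (trans (cong +_ (moment≡ (suc r))) (pos-* (bin m (suc r)) G₊)) ⟩
      + suc r * Y * (B m (suc r) * + G₊)
        ≡⟨ regroup₁ (+ suc r) Y (B m (suc r)) (+ G₊) ⟩
      Y * (+ suc r * B m (suc r)) * + G₊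
        ≡⟨ cong (λ z → Y * z * + G₊) (absorb-lower m r) ⟩
      Y * ((+ m - + r) * B m r) * + G₊
        ≡⟨ regroup₂ Y (+ m - + r) (B m r) (+ G₊) ⟩
      B m r * ((+ m - + r) * Y * + G₊)
        ≡⟨ cong (B m r *_) (containingAll-step m r ks ok) ⟩
      B m r * (prodDiff ks r * + G)
        ≡⟨ regroup₃ (B m r) (prodDiff ks r) (+ G) ⟩
      prodDiff ks r * (B m r * + G)
        ≡⟨ cong (prodDiff ks r *_) (trans (sym (pos-* (bin m r) G)) (cong +_ (sym (moment≡ r)))) ⟩
      prodDiff ks r * + moment r ∎
      where
      open ≡-Reasoning
      Y = (+ m - + r) ^ c'
      G = containingAll m ks r
      G₊ = containingAll m ks (suc r)
      regroup₁ : ∀ a y b g → a * y * (b * g) ≡ y * (a * b) * g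
      regroup₁ = solve-∀
      regroup₂ : ∀ y d b g → y * (d * b) * g ≡ b * (d * y * g)
      regroup₂ = solve-∀
      regroup₃ : ∀ b p g → b * (p * g) ≡ p * (b * g)
      regroup₃ = solve-∀

    φ-sums-to-zero : ∀ r → ΣL sample (λ t → φ m ks r (Xcap t)) ≡ 0ℤ
    φ-sums-to-zero r = begin
      ΣL sample (λ t → + suc r * Y * B (Xcap t) (suc r) + - (prodDiff ks r * B (Xcap t) r))
        ≡⟨ ΣL-+ sample (λ t → + suc r * Y * B (Xcap t) (suc r)) (λ t → - (prodDiff ks r * B (Xcap t) r)) ⟩
      ΣL sample (λ t → + suc r * Y * B (Xcap t) (suc r)) + ΣL sample (λ t → - (prodDiff ks r * B (Xcap t) r))
        ≡⟨ cong₂ _+_ (trans (ΣL-*ˡ sample (+ suc r * Y) (λ t → B (Xcap t) (suc r))) (cong (+ suc r * Y *_) (momentℤ (suc r))))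
                     (trans (ΣL-neg sample (λ t → prodDiff ks r * B (Xcap t) r))
                            (cong -_ (trans (ΣL-*ˡ sample (prodDiff ks r) (λ t → B (Xcap t) r)) (cong (prodDiff ks r *_) (momentℤ r))))) ⟩
      + suc r * Y * + moment (suc r) - prodDiff ks r * + moment r
        ≡⟨ cong (_- prodDiff ks r * + moment r) (momentRecurrence r) ⟩
      prodDiff ks r * + moment r - prodDiff ks r * + moment r
        ≡⟨ +-inverseʳ (prodDiff ks r * + moment r) ⟩
      0ℤ ∎
      where
      open ≡-Reasoning
      Y = (+ m - + r) ^ c'
      momentℤ : ∀ s → ΣL sample (λ t → B (Xcap t) s) ≡ + moment s
      momentℤ s = ΣL-pos sample (λ t → bin (Xcap t) s)

    count : ℕ → ℤ
    count a = + length (filter (λ As → Xcap As ℕ.≟ a) sample)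

    module _ (i : ℕ) where
      open Inversion m c' ks i hiding (c)

      -- Σ_tuples integrand(X∩) = (-1)^c Σ_r (-1)^(r-i) C(r, i) Σ_tuples φ_r(X∩) = 0
      integrand-total-vanishes : ΣL sample (λ t → integrand (Xcap t)) ≡ 0ℤ
      integrand-total-vanishes = begin
        ΣL sample (λ t → integrand (Xcap t))
          ≡⟨ sym (ΣL-ext sample (λ t → inversion (Xcap t) (∣p∣≤n (⋂ t)))) ⟩
        ΣL sample (λ t → sign c * combination (Xcap t))
          ≡⟨ ΣL-*ˡ sample (sign c) (λ t → combination (Xcap t)) ⟩
        sign c * ΣL sample (λ t → Σ (suc m) (λ r → weighted r (Xcap t)))
          ≡⟨ cong (sign c *_) (ΣL-Σ sample (suc m) (λ t r → weighted r (Xcap t))) ⟩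
        sign c * Σ (suc m) (λ r → ΣL sample (λ t → weighted r (Xcap t)))
          ≡⟨ cong (sign c *_) (Σ-zero (suc m) (λ r _ → weighted-sum r)) ⟩
        sign c * 0ℤ
          ≡⟨ *-zeroʳ (sign c) ⟩
        0ℤ ∎
        where
        open ≡-Reasoning
        weighted-sum : ∀ r → ΣL sample (λ t → weighted r (Xcap t)) ≡ 0ℤ
        weighted-sum r = trans (ΣL-*ˡ sample (sign (r ∸ i) * B r i) (λ t → φ m ks r (Xcap t)))
                               (trans (cong (sign (r ∸ i) * B r i *_) (φ-sums-to-zero r)) (*-zeroʳ (sign (r ∸ i) * B r i)))

      integrand-total : ΣL sample (λ t → integrand (Xcap t))
                      ≡ - D * count i + sumℤ (map (λ j → coeff j * count (i ℕ.+ j)) (range 1 c'))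
      integrand-total = begin
        ΣL sample (λ t → - D * δ i (Xcap t) + ΣL R (λ j → coeff j * δ (i ℕ.+ j) (Xcap t)))
          ≡⟨ ΣL-+ sample (λ t → - D * δ i (Xcap t)) (λ t → ΣL R (λ j → coeff j * δ (i ℕ.+ j) (Xcap t))) ⟩
        ΣL sample (λ t → - D * δ i (Xcap t)) + ΣL sample (λ t → ΣL R (λ j → coeff j * δ (i ℕ.+ j) (Xcap t)))
          ≡⟨ cong₂ _+_ (trans (ΣL-*ˡ sample (- D) (λ t → δ i (Xcap t))) (cong (- D *_) (ΣL-δ sample Xcap i)))
                       (trans (ΣL-swap sample R (λ t j → coeff j * δ (i ℕ.+ j) (Xcap t)))
                              (ΣL-ext R (λ j → trans (ΣL-*ˡ sample (coeff j) (λ t → δ (i ℕ.+ j) (Xcap t)))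
                                                     (cong (coeff j *_) (ΣL-δ sample Xcap (i ℕ.+ j)))))) ⟩
        - D * count i + sumℤ (map (λ j → coeff j * count (i ℕ.+ j)) R) ∎
        where
        open ≡-Reasoning
        R = range 1 c'

      countRecurrence : D * count i ≡ sumℤ (map (λ j → coeff j * count (i ℕ.+ j)) (range 1 c'))
      countRecurrence = begin
        D * count i                            ≡⟨ sym (+-identityʳ _) ⟩
        D * count i + 0ℤ                       ≡⟨ cong (λ z → D * count i + z) (trans (sym integrand-total-vanishes) integrand-total) ⟩
        D * count i + (- D * count i + total)  ≡⟨ cancel D (count i) total ⟩
        total                                  ∎
        where
        open ≡-Reasoning
        total = sumℤ (map (λ j → coeff j * count (i ℕ.+ j)) (range 1 c'))
        cancel : ∀ d n t → d * n + (- d * n + t) ≡ t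
        cancel = solve-∀

  -- Clearing denominators: `Represents q a d` says q = a / d; products and
  -- sums of represented rationals are represented by the integer operations.

  NonZeroℤ : ℤ → Set
  NonZeroℤ d = d ≢ 0ℤ

  NonZeroℤ-* : ∀ d e → NonZeroℤ d → NonZeroℤ e → NonZeroℤ (d * e)
  NonZeroℤ-* d e d≢0 e≢0 de≡0 with i*j≡0⇒i≡0∨j≡0 d de≡0
  ... | inj₁ d≡0 = d≢0 d≡0
  ... | inj₂ e≡0 = e≢0 e≡0

  *-cancelʳ-≢0 : ∀ a b d → NonZeroℤ d → a * d ≡ b * d → a ≡ b
  *-cancelʳ-≢0 a b (+ zero)  d≢0 _  = ⊥-elim (d≢0 refl)
  *-cancelʳ-≢0 a b (+ suc n) _   eq = *-cancelʳ-≡ a b (+ suc n) eq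
  *-cancelʳ-≢0 a b -[1+ n ]  _   eq = *-cancelʳ-≡ a b -[1+ n ] eq

  Representsᵘ : ℚᵘ → ℤ → ℤ → Set
  Representsᵘ x a d = ↥ x * d ≡ a * ↧ x

  representsᵘ-≃ : ∀ x y a d → x ℚᵘ.≃ y → Representsᵘ x a d → Representsᵘ y a d
  representsᵘ-≃ x@(mkℚᵘ xn _) y@(mkℚᵘ yn _) a d (*≡* xn*y≡yn*x) x≡a/d =
    *-cancelʳ-≢0 _ _ (↧ x) (λ ()) (begin
      yn * d * ↧ x       ≡⟨ swap yn d (↧ x) ⟩
      yn * ↧ x * d       ≡⟨ cong (_* d) (sym xn*y≡yn*x) ⟩
      xn * ↧ y * d       ≡⟨ swap xn (↧ y) d ⟩
      xn * d * ↧ y       ≡⟨ cong (_* ↧ y) x≡a/d ⟩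
      a * ↧ x * ↧ y      ≡⟨ swap a (↧ x) (↧ y) ⟩
      a * ↧ y * ↧ x      ∎)
    where
    open ≡-Reasoning
    swap : ∀ a b c → a * b * c ≡ a * c * b
    swap = solve-∀

  representsᵘ-* : ∀ x y a d b e → Representsᵘ x a d → Representsᵘ y b e → Representsᵘ (x ℚᵘ.* y) (a * b) (d * e)
  representsᵘ-* (mkℚᵘ xn xd) (mkℚᵘ yn yd) a d b e x≡a/d y≡b/e = begin
    xn * yn * (d * e)            ≡⟨ interchange xn yn d e ⟩
    (xn * d) * (yn * e)          ≡⟨ cong₂ _*_ x≡a/d y≡b/e ⟩
    (a * X) * (b * Y)            ≡⟨ interchange a X b Y ⟩
    a * b * (X * Y)              ≡⟨ cong (a * b *_) (sym (pos-* (suc xd) (suc yd))) ⟩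
    a * b * + (suc xd ℕ.* suc yd) ∎
    where
    open ≡-Reasoning
    X = + suc xd
    Y = + suc yd
    interchange : ∀ p q r s → p * q * (r * s) ≡ (p * r) * (q * s)
    interchange = solve-∀

  representsᵘ-+ : ∀ x y a b d → Representsᵘ x a d → Representsᵘ y b d → Representsᵘ (x ℚᵘ.+ y) (a + b) d
  representsᵘ-+ (mkℚᵘ xn xd) (mkℚᵘ yn yd) a b d x≡a/d y≡b/d = begin
    (xn * Y + yn * X) * d        ≡⟨ distrib xn Y yn X d ⟩
    (xn * d) * Y + (yn * d) * X  ≡⟨ cong₂ (λ p q → p * Y + q * X) x≡a/d y≡b/d ⟩
    (a * X) * Y + (b * Y) * X    ≡⟨ collect a X Y b ⟩
    (a + b) * (X * Y)            ≡⟨ cong ((a + b) *_) (sym (pos-* (suc xd) (suc yd))) ⟩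
    (a + b) * + (suc xd ℕ.* suc yd) ∎
    where
    open ≡-Reasoning
    X = + suc xd
    Y = + suc yd
    distrib : ∀ xn Y yn X d → (xn * Y + yn * X) * d ≡ (xn * d) * Y + (yn * d) * X
    distrib = solve-∀
    collect : ∀ a X Y b → (a * X) * Y + (b * Y) * X ≡ (a + b) * (X * Y)
    collect = solve-∀

  representsᵘ-neg : ∀ x a d → Representsᵘ x a d → Representsᵘ x (- a) (- d)
  representsᵘ-neg x a d x≡a/d =
    trans (sym (neg-distribʳ-* (↥ x) d)) (trans (cong -_ x≡a/d) (neg-distribˡ-* a (↧ x)))

  representsᵘ-≃-from : ∀ x y a d b e → NonZeroℤ d → NonZeroℤ e → a * e ≡ b * d →
                       Representsᵘ x a d → Representsᵘ y b e → x ℚᵘ.≃ y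
  representsᵘ-≃-from x y a d b e d≢0 e≢0 ae≡bd x≡a/d y≡b/e =
    *≡* (*-cancelʳ-≢0 _ _ (d * e) (NonZeroℤ-* d e d≢0 e≢0) (begin
      ↥ x * ↧ y * (d * e)          ≡⟨ interchange (↥ x) (↧ y) d e ⟩
      (↥ x * d) * (↧ y * e)        ≡⟨ cong (_* (↧ y * e)) x≡a/d ⟩
      (a * ↧ x) * (↧ y * e)        ≡⟨ regroup₁ a (↧ x) (↧ y) e ⟩
      (a * e) * (↧ x * ↧ y)        ≡⟨ cong (_* (↧ x * ↧ y)) ae≡bd ⟩
      (b * d) * (↧ x * ↧ y)        ≡⟨ regroup₂ b d (↧ x) (↧ y) ⟩
      (b * ↧ y) * (↧ x * d)        ≡⟨ cong (_* (↧ x * d)) (sym y≡b/e) ⟩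
      (↥ y * e) * (↧ x * d)        ≡⟨ regroup₃ (↥ y) e (↧ x) d ⟩
      ↥ y * ↧ x * (d * e)          ∎))
    where
    open ≡-Reasoning
    interchange : ∀ p y d e → p * y * (d * e) ≡ (p * d) * (y * e)
    interchange = solve-∀
    regroup₁ : ∀ a x y e → (a * x) * (y * e) ≡ (a * e) * (x * y)
    regroup₁ = solve-∀
    regroup₂ : ∀ b d x y → (b * d) * (x * y) ≡ (b * y) * (x * d)
    regroup₂ = solve-∀
    regroup₃ : ∀ p e x d → (p * e) * (x * d) ≡ p * x * (d * e)
    regroup₃ = solve-∀

  Represents : ℚ → ℤ → ℤ → Set
  Represents q a d = Representsᵘ (toℚᵘ q) a d

  represents-* : ∀ p q a d b e → Represents p a d → Represents q b e → Represents (p ℚ.* q) (a * b) (d * e)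
  represents-* p q a d b e p≡a/d q≡b/e =
    representsᵘ-≃ (toℚᵘ p ℚᵘ.* toℚᵘ q) (toℚᵘ (p ℚ.* q)) (a * b) (d * e) (ℚᵘP.≃-sym (ℚP.toℚᵘ-homo-* p q))
                  (representsᵘ-* (toℚᵘ p) (toℚᵘ q) a d b e p≡a/d q≡b/e)

  represents-+ : ∀ p q a b d → Represents p a d → Represents q b d → Represents (p ℚ.+ q) (a + b) d
  represents-+ p q a b d p≡a/d q≡b/d =
    representsᵘ-≃ (toℚᵘ p ℚᵘ.+ toℚᵘ q) (toℚᵘ (p ℚ.+ q)) (a + b) d (ℚᵘP.≃-sym (ℚP.toℚᵘ-homo-+ p q))
                  (representsᵘ-+ (toℚᵘ p) (toℚᵘ q) a b d p≡a/d q≡b/d)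

  represents-≡ : ∀ p q a d b e → NonZeroℤ d → NonZeroℤ e → a * e ≡ b * d → Represents p a d → Represents q b e → p ≡ q
  represents-≡ p q a d b e d≢0 e≢0 ae≡bd p≡a/d q≡b/e =
    ℚP.toℚᵘ-injective (representsᵘ-≃-from (toℚᵘ p) (toℚᵘ q) a d b e d≢0 e≢0 ae≡bd p≡a/d q≡b/e)

  represents-/ : ∀ z n → Represents (z ℚ./ suc n) z (+ suc n)
  represents-/ z n = representsᵘ-≃ (mkℚᵘ z n) (toℚᵘ (z ℚ./ suc n)) z (+ suc n) (ℚᵘP.≃-sym (ℚP.toℚᵘ-fromℚᵘ (mkℚᵘ z n))) refl

  represents-divℕ : ∀ a n → n ≢ 0 → Represents (divℕ a n) (+ a) (+ n)
  represents-divℕ a zero    n≢0 = ⊥-elim (n≢0 refl)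
  represents-divℕ a (suc n) _   = represents-/ (+ a) n

  represents-divℤ : ∀ a d → NonZeroℤ d → Represents (divℤ a d) a d
  represents-divℤ a (+ zero)  d≢0 = ⊥-elim (d≢0 refl)
  represents-divℤ a (+ suc d) _   = represents-/ a d
  represents-divℤ a -[1+ d ]  _   =
    subst (λ z → Represents (divℤ a -[1+ d ]) z -[1+ d ]) (neg-involutive a)
          (representsᵘ-neg (toℚᵘ (divℤ a -[1+ d ])) (- a) (+ suc d) (represents-/ (- a) d))

  represents-sumℚ : ∀ {A : Set} (L : List A) (f : A → ℚ) (g : A → ℤ) d →
                    (∀ x → Represents (f x) (g x) d) → Represents (sumℚ (map f L)) (sumℤ (map g L)) d
  represents-sumℚ []      f g d _  = *-zeroˡ d
  represents-sumℚ (x ∷ L) f g d fg =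
    represents-+ (f x) (sumℚ (map f L)) (g x) (sumℤ (map g L)) d (fg x) (represents-sumℚ L f g d fg)

  module Corollary (m c' : ℕ) (ks : Vec ℕ (suc c')) (ok : All (ℕ._≤ m) ks) where
    open SampleSpace m c' ks ok

    size≢0ℤ : NonZeroℤ (+ size)
    size≢0ℤ = size≢0 ∘ +-injective

    represents-Prob : ∀ a → Represents (Prob m ks a) (count a) (+ size)
    represents-Prob a = represents-divℕ (length (filter (λ As → Xcap As ℕ.≟ a) sample)) size size≢0

    lawRecurrence : ∀ i → denomQ ks i ≢ + 0 →
      Prob m ks i ≡ sumℚ (map (λ j → (sign j ℚ./ 1) ℚ.* ((+ ((i ℕ.+ j) C j)) ℚ./ 1) ℚ.* Q m ks i j ℚ.* Prob m ks (i ℕ.+ j))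
                              (range 1 c'))
    lawRecurrence i D≢0 =
      represents-≡ (Prob m ks i) (sumℚ (map term (range 1 c'))) (count i) (+ size) total denominator
                   size≢0ℤ denominator≢0 cross (represents-Prob i)
                   (represents-sumℚ (range 1 c') term (λ j → coeff j * count (i ℕ.+ j)) denominator represents-term)
      where
      open Inversion m c' ks i using (D; coeff)
      term : ℕ → ℚ
      term j = (sign j ℚ./ 1) ℚ.* ((+ ((i ℕ.+ j) C j)) ℚ./ 1) ℚ.* Q m ks i j ℚ.* Prob m ks (i ℕ.+ j)
      total : ℤ
      total = sumℤ (map (λ j → coeff j * count (i ℕ.+ j)) (range 1 c'))
      denominator : ℤ
      denominator = + 1 * + 1 * D * + size
      denominator≢0 : NonZeroℤ denominator
      denominator≢0 = NonZeroℤ-* (+ 1 * + 1 * D) (+ size) (NonZeroℤ-* (+ 1 * + 1) D (λ ()) D≢0) size≢0ℤ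
      represents-term : ∀ j → Represents (term j) (coeff j * count (i ℕ.+ j)) denominator
      represents-term j =
        represents-* (s ℚ.* k ℚ.* Q m ks i j) (Prob m ks (i ℕ.+ j)) (coeff j) (+ 1 * + 1 * D) (count (i ℕ.+ j)) (+ size)
          (represents-* (s ℚ.* k) (Q m ks i j) (sign j * + ((i ℕ.+ j) C j)) (+ 1 * + 1) (numQ m ks i j) D
            (represents-* s k (sign j) (+ 1) (+ ((i ℕ.+ j) C j)) (+ 1)
                          (represents-/ (sign j) 0) (represents-/ (+ ((i ℕ.+ j) C j)) 0))
            (represents-divℤ (numQ m ks i j) D D≢0))
          (represents-Prob (i ℕ.+ j))
        where
        s = sign j ℚ./ 1
        k = (+ ((i ℕ.+ j) C j)) ℚ./ 1
      cross : count i * denominator ≡ total * + size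
      cross = trans (regroup (count i) D (+ size)) (cong (_* + size) (countRecurrence i))
        where
        regroup : ∀ n d t → n * (+ 1 * + 1 * d * t) ≡ d * n * t
        regroup = solve-∀

    module _ (r : ℕ) (r<m : r ℕ.< m) where
      M : ℤ
      M = + m - + r

      M≢0 : NonZeroℤ M
      M≢0 M≡0 = ℕP.<-irrefl (+-injective (sym (i-j≡0⇒i≡j (+ m) (+ r) M≡0))) r<m

      Mᶜ≢0 : NonZeroℤ (M ^ suc c')
      Mᶜ≢0 = power≢0 (suc c')
        where
        power≢0 : ∀ n → NonZeroℤ (M ^ n)
        power≢0 zero    ()
        power≢0 (suc n) = NonZeroℤ-* M (M ^ n) M≢0 (power≢0 n)

      represents-ratioProd : Represents (ratioProd m ks r) (prodDiff ks r) (M ^ suc c')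
      represents-ratioProd = go ks
        where
        go : ∀ {n} (v : Vec ℕ n) → Represents (prodℚ (map (λ k → divℤ (+ k - + r) M) (Vec.toList v))) (prodDiff v r) (M ^ n)
        go []      = refl
        go {suc n} (k ∷ v) = represents-* (divℤ (+ k - + r) M) (prodℚ (map (λ k → divℤ (+ k - + r) M) (Vec.toList v))) (+ k - + r) M (prodDiff v r) (M ^ n)
                                  (represents-divℤ (+ k - + r) M M≢0) (go v)

      represents-b : ∀ s → Represents (Defs.b m ks s) (+ moment s) (+ size)
      represents-b s = subst (λ z → Represents (Defs.b m ks s) (+ z) (+ size))
                             (ΣLℕ-ext sample (λ As → sym (bin≡C (Xcap As) s)))
                             (represents-divℕ (ΣLℕ sample (λ As → Xcap As C s)) size size≢0)

      factorialMoment≡ : ∀ s → ΣLℕ sample (λ As → fall (Xcap As) s) ≡ s ! ℕ.* moment s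
      factorialMoment≡ s = trans (ΣLℕ-ext sample (λ As → trans (fall≡ (Xcap As) s) (ℕP.*-comm (s !) _)))
                                 (trans (ΣLℕ-*ʳ sample (λ As → bin (Xcap As) s) (s !)) (ℕP.*-comm (moment s) (s !)))

      represents-μ : ∀ s → Represents (μ m ks s) (+ (s ! ℕ.* moment s)) (+ size)
      represents-μ s = subst (λ z → Represents (μ m ks s) (+ z) (+ size)) (factorialMoment≡ s)
                             (represents-divℕ (ΣLℕ sample (λ As → fall (Xcap As) s)) size size≢0)

      binomialMomentRecurrence : Defs.b m ks (suc r) ≡ (M ℚ./ suc r) ℚ.* ratioProd m ks r ℚ.* Defs.b m ks r
      binomialMomentRecurrence =
        represents-≡ (Defs.b m ks (suc r)) ((M ℚ./ suc r) ℚ.* ratioProd m ks r ℚ.* Defs.b m ks r) (+ moment (suc r)) (+ size) (M * prodDiff ks r * + moment r) (+ suc r * M ^ suc c' * + size)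
          size≢0ℤ (NonZeroℤ-* (+ suc r * M ^ suc c') (+ size) (NonZeroℤ-* (+ suc r) (M ^ suc c') (λ ()) Mᶜ≢0) size≢0ℤ)
          cross (represents-b (suc r))
          (represents-* ((M ℚ./ suc r) ℚ.* ratioProd m ks r) (Defs.b m ks r) (M * prodDiff ks r) (+ suc r * M ^ suc c') (+ moment r) (+ size)
             (represents-* (M ℚ./ suc r) (ratioProd m ks r) M (+ suc r) (prodDiff ks r) (M ^ suc c') (represents-/ M r) represents-ratioProd)
             (represents-b r))
        where
        cross : + moment (suc r) * (+ suc r * M ^ suc c' * + size) ≡ M * prodDiff ks r * + moment r * + size
        cross = begin
          + moment (suc r) * (+ suc r * (M * M ^ c') * + size)  ≡⟨ regroup₁ (+ moment (suc r)) (+ suc r) M (M ^ c') (+ size) ⟩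
          M * + size * (+ suc r * M ^ c' * + moment (suc r))    ≡⟨ cong (M * + size *_) (momentRecurrence r) ⟩
          M * + size * (prodDiff ks r * + moment r)             ≡⟨ regroup₂ M (+ size) (prodDiff ks r) (+ moment r) ⟩
          M * prodDiff ks r * + moment r * + size               ∎
          where
          open ≡-Reasoning
          regroup₁ : ∀ b s M P t → b * (s * (M * P) * t) ≡ M * t * (s * P * b)
          regroup₁ = solve-∀
          regroup₂ : ∀ M t p b → M * t * (p * b) ≡ M * p * b * t
          regroup₂ = solve-∀

      factorialMomentRecurrence : μ m ks (suc r) ≡ (M ℚ./ 1) ℚ.* ratioProd m ks r ℚ.* μ m ks r
      factorialMomentRecurrence =
        represents-≡ (μ m ks (suc r)) ((M ℚ./ 1) ℚ.* ratioProd m ks r ℚ.* μ m ks r) (+ F (suc r)) (+ size) (M * prodDiff ks r * + F r) (+ 1 * M ^ suc c' * + size)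
          size≢0ℤ (NonZeroℤ-* (+ 1 * M ^ suc c') (+ size) (NonZeroℤ-* (+ 1) (M ^ suc c') (λ ()) Mᶜ≢0) size≢0ℤ)
          cross (represents-μ (suc r))
          (represents-* ((M ℚ./ 1) ℚ.* ratioProd m ks r) (μ m ks r) (M * prodDiff ks r) (+ 1 * M ^ suc c') (+ F r) (+ size)
             (represents-* (M ℚ./ 1) (ratioProd m ks r) M (+ 1) (prodDiff ks r) (M ^ suc c') (represents-/ M 0) represents-ratioProd)
             (represents-μ r))
        where
        F : ℕ → ℕ
        F s = s ! ℕ.* moment s
        cross : + F (suc r) * (+ 1 * M ^ suc c' * + size) ≡ M * prodDiff ks r * + F r * + size
        cross = begin
          + F (suc r) * (+ 1 * (M * M ^ c') * + size)
            ≡⟨ cong (_* (+ 1 * (M * M ^ c') * + size)) (trans (pos-* ((suc r) !) (moment (suc r))) (cong (_* + moment (suc r)) (pos-* (suc r) (r !)))) ⟩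
          + suc r * + (r !) * + moment (suc r) * (+ 1 * (M * M ^ c') * + size)
            ≡⟨ regroup₁ (+ suc r) (+ (r !)) (+ moment (suc r)) M (M ^ c') (+ size) ⟩
          + (r !) * M * + size * (+ suc r * M ^ c' * + moment (suc r))
            ≡⟨ cong (+ (r !) * M * + size *_) (momentRecurrence r) ⟩
          + (r !) * M * + size * (prodDiff ks r * + moment r)
            ≡⟨ regroup₂ (+ (r !)) M (+ size) (prodDiff ks r) (+ moment r) ⟩
          M * prodDiff ks r * (+ (r !) * + moment r) * + size
            ≡⟨ cong (λ z → M * prodDiff ks r * z * + size) (sym (pos-* (r !) (moment r))) ⟩
          M * prodDiff ks r * + F r * + size ∎
          where
          open ≡-Reasoning
          regroup₁ : ∀ s f b M P t → s * f * b * (+ 1 * (M * P) * t) ≡ f * M * t * (s * P * b)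
          regroup₁ = solve-∀
          regroup₂ : ∀ f M t p b → f * M * t * (p * b) ≡ M * p * (f * b) * t
          regroup₂ = solve-∀


open import Defs
open import Data.Nat as ℕ using (ℕ; suc; _≤_; _<_; _∸_)
open import Data.Integer as ℤ using (ℤ; +_)
open import Data.Rational using (ℚ; _+_; _*_; _/_)
open import Data.Nat.Combinatorics using (_C_)
open import Data.Vec using (Vec)
open import Data.Vec.Relation.Unary.All using (All)
open import Data.List using (map)
open import Data.Product using (_×_; _,_)
open import Relation.Binary.PropositionalEquality using (_≡_; _≢_)
open Development using (module Corollary)

corollary2p11 : (m c : ℕ) → 1 ≤ m → 1 ≤ c → (ks : Vec ℕ c) → All (_≤ m) ks →
    ((i : ℕ) → denomQ ks i ≢ + 0 →
      Prob m ks i ≡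
        sumℚ (map (λ j → (sign j / 1) * ((+ ((i ℕ.+ j) C j)) / 1)
                          * Q m ks i j * Prob m ks (i ℕ.+ j))
                  (range 1 (c ∸ 1))))
    × ((r : ℕ) → r < m →
        (μ m ks (suc r) ≡ (((+ m) ℤ.- (+ r)) / 1) * ratioProd m ks r * μ m ks r)
        × (b m ks (suc r) ≡ (((+ m) ℤ.- (+ r)) / suc r) * ratioProd m ks r * b m ks r))
-- The case c = 0 is excluded by 1 ≤ c; otherwise the three parts are proved in `Corollary`.
corollary2p11 m ℕ.zero   _ () ks ok
corollary2p11 m (suc c') _ _  ks ok =
  lawRecurrence , λ r r<m → factorialMomentRecurrence r r<m , binomialMomentRecurrence r r<m
  where open Corollary m c' ks ok
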